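{- Let $n>14$ and let $X=\{X_1,X_2\}$ be a $\lambda_2$-equitable $2$-partition of $J(n,3)$ (with $\lambda_2=n-7$) whose quotient matrix $(p_{ij})$ satisfies $p_{11}\geq p_{22}$ and $p_{11}\geq 2n-7$. Suppose there is a vertex $\{a,b,c\}\in X_1$ with $\overline{ab\ast}=\overline{ac\ast}$ and $\overline{ac\ast}-\overline{bc\ast}=(n-4)/2$ such that for every $d\in[n]\setminus\{a,b,c\}$ the triple $(\overline{abd},\overline{acd},\overline{bcd})$ is one of $(1,1,1)$, $(1,1,0)$, $(0,0,0)$. Then there exist $m$ with $n=2m$ and a partition $[n]=U\cup W$, $U=\{u_1,\dots,u_m\}$, $W=\{w_1,\dots,w_m\}$, such that $\{X_1,X_2\}=\Pi_1$ as unordered partitions.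
   Context: $J(n,3)$: vertices are the $3$-subsets of $[n]=\{1,\dots,n\}$, adjacent iff they share exactly two elements; it is $3(n-3)$-regular. An equitable $2$-partition $\{X_1,X_2\}$ with quotient matrix $(p_{ij})$ means each vertex of $X_i$ has exactly $p_{ij}$ neighbours in $X_j$; it is $\lambda_2$-equitable if $p_{11}-p_{21}=n-7$. For a vertex $u$, $\overline{u}=1$ if $u\in X_1$ and $0$ if $u\in X_2$; $\overline{xyz}=\overline{\{x,y,z\}}$. For distinct $i,j$, $\overline{ij\ast}$ is the number of $3$-subsets containing $i$ and $j$ that lie in $X_1$. Given a partition $[2m]=U\cup W$ with $U=\{u_1,\dots,u_m\}$, $W=\{w_1,\dots,w_m\}$: $Y_1$ = $3$-subsets contained in $U$ or in $W$; $Y_2$ = sets $\{u_i,u_j,w_i\}$, $\{w_i,w_j,u_i\}$ ($i\neq j$); $Y_3$ = sets $\{u_i,u_j,w_k\}$, $\{w_i,w_j,u_k\}$ ($i,j,k$ distinct); $\Pi_1=\{Y_2\cup Y_3,\,Y_1\}$. -}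

module Defs where

open import Data.Nat using (ℕ; zero; suc; _+_; _*_; _∸_; _≤_; _<_; _≥_; _>_)
open import Data.Bool using (Bool; true; false; _∧_)
open import Data.Fin using (Fin)
open import Data.Fin.Subset using (Subset; ⁅_⁆; _∪_; _∩_; ∣_∣; _∈_; _∉_)
open import Data.Vec using (Vec; []; _∷_)
open import Data.List using (List; []; _∷_; map; _++_; length; filter)
open import Data.Product using (Σ; ∃; ∃-syntax; _×_; _,_)
open import Data.Sum using (_⊎_; inj₁; inj₂; [_,_])
open import Relation.Binary.PropositionalEquality using (_≡_; _≢_)
open import Relation.Nullary using (¬_; Dec; yes; no)
open import Relation.Unary using (Pred; Decidable)
open import Data.Nat using (_≟_)
open import Data.Fin.Subset.Properties using (_∈?_)
open import Function.Definitions using (Bijective)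
open import Function using (_⇔_)
import Agda.Primitive
import Data.Bool

allSubsets : (n : ℕ) → List (Subset n)
allSubsets zero = [] ∷ []
allSubsets (suc n) = map (true ∷_) (allSubsets n) ++ map (false ∷_) (allSubsets n)

countSubsets : {n : ℕ} {P : Pred (Subset n) Agda.Primitive.lzero} → Decidable P → ℕ
countSubsets {n} P? = length (filter P? (allSubsets n))

IsTriple : {n : ℕ} → Subset n → Set
IsTriple s = ∣ s ∣ ≡ 3

triple : {n : ℕ} → Fin n → Fin n → Fin n → Subset n
triple x y z = (⁅ x ⁆ ∪ ⁅ y ⁆) ∪ ⁅ z ⁆

Adjacent : {n : ℕ} → Subset n → Subset n → Set
Adjacent s t = ∣ s ∩ t ∣ ≡ 2

-- A 2-partition {X₁,X₂} of J(n,3) is encoded by its indicator χ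
-- (χ s = true iff s ∈ X₁, χ s = false iff s ∈ X₂), evaluated on 3-subsets.
neighboursIn : {n : ℕ} → (Subset n → Bool) → Subset n → Bool → ℕ
neighboursIn χ u b = countSubsets (λ v → dec v)
  where
  dec : ∀ v → Dec ((∣ v ∣ ≡ 3) × (∣ u ∩ v ∣ ≡ 2) × (χ v ≡ b))
  dec v with ∣ v ∣ ≟ 3 | ∣ u ∩ v ∣ ≟ 2 | Data.Bool._≟_ (χ v) b
  ... | yes p | yes q | yes r = yes (p , q , r)
  ... | no ¬p | _ | _ = no λ { (p , _ , _) → ¬p p }
  ... | yes _ | no ¬q | _ = no λ { (_ , q , _) → ¬q q }
  ... | yes _ | yes _ | no ¬r = no λ { (_ , _ , r) → ¬r r }

-- colour of part i (1 ↦ true = X₁, 2 ↦ false = X₂)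
col : Fin 2 → Bool
col Fin.zero = true
col (Fin.suc _) = false

IsTwoPartition : (n : ℕ) → (Subset n → Bool) → Set
IsTwoPartition n χ =
  (∃[ s ] (IsTriple s × χ s ≡ true)) × (∃[ s ] (IsTriple s × χ s ≡ false))

IsEquitableWith : (n : ℕ) → (Subset n → Bool) → (Fin 2 → Fin 2 → ℕ) → Set
IsEquitableWith n χ p =
  IsTwoPartition n χ ×
  (∀ (i j : Fin 2) (u : Subset n) → IsTriple u → χ u ≡ col i →
     neighboursIn χ u (col j) ≡ p i j)

pairCount : {n : ℕ} → (Subset n → Bool) → Fin n → Fin n → ℕ
pairCount {n} χ i j = countSubsets (λ v → dec v)
  where
  dec : ∀ v → Dec ((∣ v ∣ ≡ 3) × (i ∈ v) × (j ∈ v) × (χ v ≡ true))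
  dec v with ∣ v ∣ ≟ 3 | i ∈? v | j ∈? v | Data.Bool._≟_ (χ v) true
  ... | yes p | yes q | yes r | yes t = yes (p , q , r , t)
  ... | no ¬p | _ | _ | _ = no λ { (p , _ , _ , _) → ¬p p }
  ... | yes _ | no ¬q | _ | _ = no λ { (_ , q , _ , _) → ¬q q }
  ... | yes _ | yes _ | no ¬r | _ = no λ { (_ , _ , r , _) → ¬r r }
  ... | yes _ | yes _ | yes _ | no ¬t = no λ { (_ , _ , _ , t) → ¬t t }

module Pi1 {n m : ℕ} (u w : Fin m → Fin n) where
  Y₁ : Subset n → Set
  Y₁ s = ∃[ i ] ∃[ j ] ∃[ k ] (i ≢ j × j ≢ k × i ≢ k ×
           (s ≡ triple (u i) (u j) (u k) ⊎ s ≡ triple (w i) (w j) (w k)))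
  Y₂ : Subset n → Set
  Y₂ s = ∃[ i ] ∃[ j ] (i ≢ j ×
           (s ≡ triple (u i) (u j) (w i) ⊎ s ≡ triple (w i) (w j) (u i)))
  Y₃ : Subset n → Set
  Y₃ s = ∃[ i ] ∃[ j ] ∃[ k ] (i ≢ j × j ≢ k × i ≢ k ×
           (s ≡ triple (u i) (u j) (w k) ⊎ s ≡ triple (w i) (w j) (u k)))

EqualsPi1 : {n m : ℕ} → (Subset n → Bool) → (Fin m → Fin n) → (Fin m → Fin n) → Set
EqualsPi1 {n} χ u w =
  (∀ s → IsTriple s → ((χ s ≡ true ⇔ (Y₂ s ⊎ Y₃ s)) × (χ s ≡ false ⇔ Y₁ s)))
  ⊎
  (∀ s → IsTriple s → ((χ s ≡ true ⇔ Y₁ s) × (χ s ≡ false ⇔ (Y₂ s ⊎ Y₃ s))))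
  where open Pi1 u w

module Submission where

-- Write g(x,y) for the number of triples {x,y,d} in X₁.  Summing g over the three pairs of a
-- triple T counts T three times and each X₁-neighbour of T once, so λ₂-equitability gives
-- g(x,y) + g(x,z) + g(y,z) = p₂₁ + [T ∈ X₁]·(n-4).  At {a,b,c} the profile hypothesis gives
-- g(a,b) = g(a,c) = s + β and g(b,c) = s, where s - 1 and β count the outside d with
-- {b,c,d} ∈ X₁, respectively with {a,b,d} ∈ X₁ but {b,c,d} ∉ X₁; the hypothesis on
-- g(a,c) - g(b,c) says n - 4 = 2β, and then p₂₁ = 3s.  Solving the three identities through an
-- outside d gives g(a,d), g(b,d), g(c,d); a vertex of profile (0,0,0) would force β = s and
-- hence a second one d′ with g(d,d′) = 3s > n - 2.  So n = 2s, and with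
-- U = {x ∉ {b,c} : {b,c,x} ∈ X₁} every g(x,y) is s or s + β = n - 2 according as x, y lie on
-- the same side of U or not: a split pair lies only in X₁-triples, and a monochromatic triple
-- has codegree sum 3s, so it lies in X₂.

open import Defs
open import Data.Nat using (ℕ; zero; suc; _+_; _*_; _∸_; _≤_; _<_; _≥_; _>_; z≤n; s≤s)
open import Data.Nat.Properties hiding (_≟_)
open import Data.Bool using (Bool; true; false; _∧_; _∨_; not; _xor_)
import Data.Bool as Bool
open import Data.Bool.Properties
  using (not-injective; not-involutive; ∧-assoc; ∧-conicalˡ; ∧-conicalʳ; ∧-identityʳ; ∧-zeroʳ;
         ∨-comm; ∨-assoc; ∨-zeroʳ; ∨-identityʳ; xor-comm; xor-same)
open import Algebra.Properties.CommutativeSemigroup +-commutativeSemigroup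
  using (interchange; x∙yz≈y∙xz)
open import Data.Fin using (Fin; zero; suc; _≟_)
open import Data.Fin.Subset using (Subset; ⁅_⁆; _∪_; _∩_; ∣_∣; _∈_)
open import Data.Vec using ([]; _∷_; lookup)
open import Data.Vec.Properties
  using (lookup-zipWith; lookup-replicate; ≡-dec; []=⇒lookup; lookup⇒[]=; tabulate∘lookup; tabulate-cong)
open import Data.List using (List; []; _∷_; map; _++_; length; filter)
open import Data.List.Properties using (map-++; map-∘)
open import Data.Nat.ListAction using (sum)
open import Data.Nat.ListAction.Properties using (sum-++)
open import Data.Product using (∃-syntax; Σ-syntax; _×_; _,_; proj₁; proj₂)
open import Data.Sum using (_⊎_; inj₁; inj₂; [_,_])
import Data.Sum
import Data.Fin.Properties
open import Function.Definitions using (Bijective; Injective; Surjective)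
open import Data.Empty using (⊥; ⊥-elim)
open import Function using (_∘_; const)
open import Function.Bundles using (mk⇔)
open import Relation.Binary.PropositionalEquality hiding ([_])
open import Relation.Nullary using (¬_; yes; no; does; contradiction)
open import Data.Nat.Tactic.RingSolver using (solve-∀)
open import Relation.Nullary.Decidable using (dec-true; dec-false)
open import Relation.Unary using (Pred; Decidable)
open import Level using (0ℓ)

-- Counting Boolean predicates on Fin n

toℕ : Bool → ℕ
toℕ true = 1
toℕ false = 0

count : {n : ℕ} → (Fin n → Bool) → ℕ
count {zero} f = 0
count {suc n} f = toℕ (f zero) + count (f ∘ suc)

count-cong : {n : ℕ} {f g : Fin n → Bool} → (∀ i → f i ≡ g i) → count f ≡ count g
count-cong {zero} e = refl
count-cong {suc n} e = cong₂ _+_ (cong toℕ (e zero)) (count-cong (e ∘ suc))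

count-false : {n : ℕ} (f : Fin n → Bool) → (∀ i → f i ≡ false) → count f ≡ 0
count-false {zero} f e = refl
count-false {suc n} f e rewrite e zero = count-false (f ∘ suc) (e ∘ suc)

count≡0⇒false : {n : ℕ} (f : Fin n → Bool) → count f ≡ 0 → ∀ i → f i ≡ false
count≡0⇒false {suc n} f e i with f zero in f0
count≡0⇒false {suc n} f e zero    | false = f0
count≡0⇒false {suc n} f e (suc i) | false = count≡0⇒false (f ∘ suc) e i

count>0⇒∃ : {n : ℕ} (f : Fin n → Bool) → 0 < count f → ∃[ i ] f i ≡ true
count>0⇒∃ {suc n} f p with f zero in f0
... | true = zero , f0
... | false = let i , fi = count>0⇒∃ (f ∘ suc) p in suc i , fi

count-const-true : {n : ℕ} → count {n} (const true) ≡ n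
count-const-true {zero} = refl
count-const-true {suc n} = cong suc count-const-true

count-split : {n : ℕ} (f g : Fin n → Bool) →
              count f ≡ count (λ i → f i ∧ g i) + count (λ i → f i ∧ not (g i))
count-split {zero} f g = refl
count-split {suc n} f g with f zero | g zero | count-split (f ∘ suc) (g ∘ suc)
... | true  | true  | ih = cong suc ih
... | true  | false | ih = trans (cong suc ih) (sym (+-suc _ _))
... | false | _     | ih = ih

count-mono : {n : ℕ} (f g : Fin n → Bool) → (∀ i → f i ≡ true → g i ≡ true) → count f ≤ count g
count-mono {zero} f g h = z≤n
count-mono {suc n} f g h with f zero in f0 | g zero in g0
... | true  | true  = s≤s (count-mono _ _ (h ∘ suc))
... | true  | false = contradiction (trans (sym g0) (h zero f0)) λ ()
... | false | true  = m≤n⇒m≤1+n (count-mono _ _ (h ∘ suc))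
... | false | false = count-mono _ _ (h ∘ suc)

count-complement : {n : ℕ} (f : Fin n → Bool) → count f + count (not ∘ f) ≡ n
count-complement {n} f = sym (trans (sym count-const-true) (count-split (const true) f))

count-≡⇒⊇ : {n : ℕ} (f g : Fin n → Bool) → (∀ i → f i ≡ true → g i ≡ true) →
            count f ≡ count g → ∀ i → g i ≡ true → f i ≡ true
count-≡⇒⊇ {suc n} f g h e i gi with f zero in f0 | g zero in g0
count-≡⇒⊇ {suc n} f g h e zero    gi | true  | _     = f0
count-≡⇒⊇ {suc n} f g h e (suc i) gi | true  | true  = count-≡⇒⊇ _ _ (h ∘ suc) (suc-injective e) i gi
count-≡⇒⊇ {suc n} f g h e i       gi | true  | false = contradiction (trans (sym g0) (h zero f0)) λ ()
count-≡⇒⊇ {suc n} f g h e i       gi | false | true  =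
  contradiction (subst (_≤ count (g ∘ suc)) e (count-mono _ _ (h ∘ suc))) (<-irrefl refl)
count-≡⇒⊇ {suc n} f g h e zero    gi | false | false = contradiction (trans (sym gi) g0) λ ()
count-≡⇒⊇ {suc n} f g h e (suc i) gi | false | false = count-≡⇒⊇ _ _ (h ∘ suc) e i gi

infix 4 _==_
_==_ : {n : ℕ} → Fin n → Fin n → Bool
i == j = does (i ≟ j)

==-refl : {n : ℕ} (i : Fin n) → (i == i) ≡ true
==-refl i = dec-true (i ≟ i) refl

≢⇒==-false : {n : ℕ} {i j : Fin n} → i ≢ j → (i == j) ≡ false
≢⇒==-false {i = i} {j} = dec-false (i ≟ j)

==-true⇒≡ : {n : ℕ} {i j : Fin n} → (i == j) ≡ true → i ≡ j
==-true⇒≡ {i = i} {j} e with i ≟ j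
... | yes i≡j = i≡j

count-remove : {n : ℕ} (f : Fin n → Bool) (x : Fin n) →
               count f ≡ toℕ (f x) + count (λ i → f i ∧ not (i == x))
count-remove {suc n} f zero rewrite ∧-zeroʳ (f zero) =
  cong (toℕ (f zero) +_) (count-cong (λ i → sym (∧-identityʳ (f (suc i)))))
count-remove {suc n} f (suc x)
  rewrite count-remove (f ∘ suc) x | ∧-identityʳ (f zero) =
  x∙yz≈y∙xz (toℕ (f zero)) (toℕ (f (suc x))) (count (λ i → f (suc i) ∧ not (i == x)))

count-remove-true : {n : ℕ} (f : Fin n → Bool) {x : Fin n} → f x ≡ true →
                    count f ≡ suc (count (λ i → f i ∧ not (i == x)))
count-remove-true f {x} fx = trans (count-remove f x) (cong (λ b → toℕ b + count (λ i → f i ∧ not (i == x))) fx)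

∈-minus-point : {n : ℕ} (f : Fin n → Bool) {x i : Fin n} → f i ∧ not (i == x) ≡ true → f i ≡ true × i ≢ x
∈-minus-point f {x} {i} e with f i | i ≟ x
... | true | no i≢x = refl , i≢x

count≡1⇒point : {n : ℕ} (f : Fin n → Bool) (x : Fin n) → count f ≡ 1 → f x ≡ true →
                ∀ i → f i ≡ (i == x)
count≡1⇒point f x c fx i with i ≟ x
... | yes refl = fx
... | no i≢x = begin
  f i                   ≡⟨ ∧-identityʳ (f i) ⟨
  f i ∧ not false       ≡⟨ cong (λ b → f i ∧ not b) (≢⇒==-false i≢x) ⟨
  f i ∧ not (i == x)    ≡⟨ count≡0⇒false _ rest≡0 i ⟩
  false                 ∎
  where
  open ≡-Reasoning
  rest≡0 : count (λ i → f i ∧ not (i == x)) ≡ 0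
  rest≡0 = suc-injective (trans (sym (trans (count-remove f x) (cong (λ b → toℕ b + count (λ i → f i ∧ not (i == x))) fx))) c)

count-supported : {n : ℕ} (f : Fin n → Bool) (x : Fin n) → (∀ i → i ≢ x → f i ≡ false) → count f ≡ toℕ (f x)
count-supported f x off-x = begin
  count f                                           ≡⟨ count-remove f x ⟩
  toℕ (f x) + count (λ i → f i ∧ not (i == x))      ≡⟨ cong (toℕ (f x) +_) (count-false _ off) ⟩
  toℕ (f x) + 0                                     ≡⟨ +-identityʳ _ ⟩
  toℕ (f x)                                         ∎
  where
  open ≡-Reasoning
  off : ∀ i → f i ∧ not (i == x) ≡ false
  off i with i ≟ x
  ... | yes _  = ∧-zeroʳ (f i)
  ... | no i≢x rewrite off-x i i≢x = refl

count-point-∧ : {n : ℕ} (x : Fin n) (f : Fin n → Bool) → count (λ i → (i == x) ∧ f i) ≡ toℕ (f x)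
count-point-∧ x f = begin
  count (λ i → (i == x) ∧ f i)                               ≡⟨ count-remove _ x ⟩
  toℕ ((x == x) ∧ f x) + count (λ i → ((i == x) ∧ f i) ∧ not (i == x))
    ≡⟨ cong₂ _+_ (cong (λ b → toℕ (b ∧ f x)) (==-refl x)) (count-false _ off-x) ⟩
  toℕ (f x) + 0                                              ≡⟨ +-identityʳ _ ⟩
  toℕ (f x)                                                  ∎
  where
  open ≡-Reasoning
  off-x : ∀ i → ((i == x) ∧ f i) ∧ not (i == x) ≡ false
  off-x i with i == x
  ... | true  = ∧-zeroʳ (f i)
  ... | false = refl

count-∨-point-∧ : {n : ℕ} (A f : Fin n → Bool) (z : Fin n) → A z ≡ false →
                  count (λ i → (A i ∨ (i == z)) ∧ f i) ≡ count (λ i → A i ∧ f i) + toℕ (f z)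
count-∨-point-∧ A f z Az = begin
  count (λ i → (A i ∨ (i == z)) ∧ f i)
    ≡⟨ count-remove _ z ⟩
  toℕ ((A z ∨ (z == z)) ∧ f z) + count (λ i → ((A i ∨ (i == z)) ∧ f i) ∧ not (i == z))
    ≡⟨ cong₂ _+_ (trans (cong (λ b → toℕ ((A z ∨ b) ∧ f z)) (==-refl z)) (cong (λ b → toℕ (b ∧ f z)) (∨-zeroʳ (A z))))
                 (count-cong off-z) ⟩
  toℕ (f z) + count (λ i → (A i ∧ f i) ∧ not (i == z))
    ≡⟨ +-comm (toℕ (f z)) _ ⟩
  count (λ i → (A i ∧ f i) ∧ not (i == z)) + toℕ (f z)
    ≡⟨ cong (λ b → toℕ (b ∧ f z) + count (λ i → (A i ∧ f i) ∧ not (i == z)) + toℕ (f z)) Az ⟨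
  toℕ (A z ∧ f z) + count (λ i → (A i ∧ f i) ∧ not (i == z)) + toℕ (f z)
    ≡⟨ cong (_+ toℕ (f z)) (count-remove (λ i → A i ∧ f i) z) ⟨
  count (λ i → A i ∧ f i) + toℕ (f z) ∎
  where
  open ≡-Reasoning
  off-z : ∀ i → ((A i ∨ (i == z)) ∧ f i) ∧ not (i == z) ≡ (A i ∧ f i) ∧ not (i == z)
  off-z i with i == z
  ... | true  = trans (∧-zeroʳ _) (sym (∧-zeroʳ _))
  ... | false = cong (λ b → (b ∧ f i) ∧ true) (∨-identityʳ (A i))

count-pair : {n : ℕ} {x y : Fin n} → x ≢ y → count (λ i → (i == x) ∨ (i == y)) ≡ 2
count-pair {x = x} {y} x≢y = begin
  count (λ i → (i == x) ∨ (i == y))            ≡⟨ count-cong (λ i → ∧-identityʳ ((i == x) ∨ (i == y))) ⟨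
  count (λ i → ((i == x) ∨ (i == y)) ∧ true)   ≡⟨ count-∨-point-∧ (_== x) (const true) y (≢⇒==-false (≢-sym x≢y)) ⟩
  count (λ i → (i == x) ∧ true) + 1            ≡⟨ cong (_+ 1) (count-point-∧ x (const true)) ⟩
  2                                            ∎
  where open ≡-Reasoning

-- Triples

∣∣≡count : {n : ℕ} (s : Subset n) → ∣ s ∣ ≡ count (lookup s)
∣∣≡count [] = refl
∣∣≡count (true ∷ s) = cong suc (∣∣≡count s)
∣∣≡count (false ∷ s) = ∣∣≡count s

subset-ext : {n : ℕ} {s t : Subset n} → (∀ i → lookup s i ≡ lookup t i) → s ≡ t
subset-ext {s = s} {t} e = trans (sym (tabulate∘lookup s)) (trans (tabulate-cong e) (tabulate∘lookup t))

lookup-⁅⁆ : {n : ℕ} (x i : Fin n) → lookup ⁅ x ⁆ i ≡ (i == x)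
lookup-⁅⁆ zero zero = refl
lookup-⁅⁆ zero (suc i) = lookup-replicate i false
lookup-⁅⁆ (suc x) zero = refl
lookup-⁅⁆ (suc x) (suc i) = lookup-⁅⁆ x i

lookup-triple : {n : ℕ} (x y z i : Fin n) → lookup (triple x y z) i ≡ ((i == x) ∨ (i == y)) ∨ (i == z)
lookup-triple x y z i
  rewrite lookup-zipWith _∨_ i (⁅ x ⁆ ∪ ⁅ y ⁆) ⁅ z ⁆ | lookup-zipWith _∨_ i ⁅ x ⁆ ⁅ y ⁆
        | lookup-⁅⁆ x i | lookup-⁅⁆ y i | lookup-⁅⁆ z i = refl

module _ {n : ℕ} (x y z : Fin n) where

  triple∋₁ : lookup (triple x y z) x ≡ true
  triple∋₁ rewrite lookup-triple x y z x | ==-refl x = refl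

  triple∋₂ : lookup (triple x y z) y ≡ true
  triple∋₂ rewrite lookup-triple x y z y | ==-refl y = cong (_∨ (y == z)) (∨-zeroʳ (y == x))

  triple∋₃ : lookup (triple x y z) z ≡ true
  triple∋₃ rewrite lookup-triple x y z z | ==-refl z = ∨-zeroʳ _

  triple∌ : ∀ {i} → i ≢ x → i ≢ y → i ≢ z → lookup (triple x y z) i ≡ false
  triple∌ {i} i≢x i≢y i≢z
    rewrite lookup-triple x y z i | ≢⇒==-false i≢x | ≢⇒==-false i≢y | ≢⇒==-false i≢z = refl

  triple-comm₁₂ : triple x y z ≡ triple y x z
  triple-comm₁₂ = subset-ext λ i → begin
    lookup (triple x y z) i             ≡⟨ lookup-triple x y z i ⟩
    ((i == x) ∨ (i == y)) ∨ (i == z)    ≡⟨ cong (_∨ (i == z)) (∨-comm (i == x) (i == y)) ⟩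
    ((i == y) ∨ (i == x)) ∨ (i == z)    ≡⟨ lookup-triple y x z i ⟨
    lookup (triple y x z) i             ∎
    where open ≡-Reasoning

  triple-comm₂₃ : triple x y z ≡ triple x z y
  triple-comm₂₃ = subset-ext λ i → begin
    lookup (triple x y z) i             ≡⟨ lookup-triple x y z i ⟩
    ((i == x) ∨ (i == y)) ∨ (i == z)    ≡⟨ ∨-assoc (i == x) (i == y) (i == z) ⟩
    (i == x) ∨ ((i == y) ∨ (i == z))    ≡⟨ cong ((i == x) ∨_) (∨-comm (i == y) (i == z)) ⟩
    (i == x) ∨ ((i == z) ∨ (i == y))    ≡⟨ ∨-assoc (i == x) (i == z) (i == y) ⟨
    ((i == x) ∨ (i == z)) ∨ (i == y)    ≡⟨ lookup-triple x z y i ⟨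
    lookup (triple x z y) i             ∎
    where open ≡-Reasoning

triple-rotate : {n : ℕ} (x y z : Fin n) → triple x y z ≡ triple y z x
triple-rotate x y z = trans (triple-comm₁₂ x y z) (triple-comm₂₃ y x z)

triple∌⇒≢ : {n : ℕ} {x y z d : Fin n} → lookup (triple x y z) d ≡ false → d ≢ x × d ≢ y × d ≢ z
triple∌⇒≢ {x = x} {y} {z} {d} e =
  (λ { refl → contradiction (trans (sym (triple∋₁ x y z)) e) λ () }) ,
  (λ { refl → contradiction (trans (sym (triple∋₂ x y z)) e) λ () }) ,
  (λ { refl → contradiction (trans (sym (triple∋₃ x y z)) e) λ () })

triple-injective₃ : {n : ℕ} {x y d d′ : Fin n} → d ≢ x → d ≢ y → triple x y d ≡ triple x y d′ → d ≡ d′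
triple-injective₃ {x = x} {y} {d} {d′} d≢x d≢y e = ==-true⇒≡ (begin
  d == d′                                  ≡⟨⟩
  (false ∨ false) ∨ (d == d′)              ≡⟨ cong (λ b → (b ∨ false) ∨ (d == d′)) (≢⇒==-false d≢x) ⟨
  ((d == x) ∨ false) ∨ (d == d′)           ≡⟨ cong (λ b → ((d == x) ∨ b) ∨ (d == d′)) (≢⇒==-false d≢y) ⟨
  ((d == x) ∨ (d == y)) ∨ (d == d′)        ≡⟨ lookup-triple x y d′ d ⟨
  lookup (triple x y d′) d                 ≡⟨ cong (λ s → lookup s d) e ⟨
  lookup (triple x y d) d                  ≡⟨ triple∋₃ x y d ⟩
  true                                     ∎)
  where open ≡-Reasoning

count-triple-∧ : {n : ℕ} {x y z : Fin n} → x ≢ y → x ≢ z → y ≢ z → (f : Fin n → Bool) →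
                 count (λ i → lookup (triple x y z) i ∧ f i) ≡ toℕ (f x) + toℕ (f y) + toℕ (f z)
count-triple-∧ {x = x} {y} {z} x≢y x≢z y≢z f = begin
  count (λ i → lookup (triple x y z) i ∧ f i)            ≡⟨ count-cong (λ i → cong (_∧ f i) (lookup-triple x y z i)) ⟩
  count (λ i → (((i == x) ∨ (i == y)) ∨ (i == z)) ∧ f i) ≡⟨ count-∨-point-∧ _ f z z∉xy ⟩
  count (λ i → ((i == x) ∨ (i == y)) ∧ f i) + toℕ (f z)
    ≡⟨ cong (_+ toℕ (f z)) (count-∨-point-∧ _ f y (≢⇒==-false (≢-sym x≢y))) ⟩
  count (λ i → (i == x) ∧ f i) + toℕ (f y) + toℕ (f z)
    ≡⟨ cong (λ k → k + toℕ (f y) + toℕ (f z)) (count-point-∧ x f) ⟩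
  toℕ (f x) + toℕ (f y) + toℕ (f z)                      ∎
  where
  open ≡-Reasoning
  z∉xy : (z == x) ∨ (z == y) ≡ false
  z∉xy rewrite ≢⇒==-false (≢-sym x≢z) | ≢⇒==-false (≢-sym y≢z) = refl

∣triple∩∣ : {n : ℕ} {x y z : Fin n} → x ≢ y → x ≢ z → y ≢ z → (s : Subset n) →
            ∣ triple x y z ∩ s ∣ ≡ toℕ (lookup s x) + toℕ (lookup s y) + toℕ (lookup s z)
∣triple∩∣ {x = x} {y} {z} x≢y x≢z y≢z s = begin
  ∣ triple x y z ∩ s ∣                             ≡⟨ ∣∣≡count (triple x y z ∩ s) ⟩
  count (lookup (triple x y z ∩ s))                ≡⟨ count-cong (λ i → lookup-zipWith _∧_ i (triple x y z) s) ⟩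
  count (λ i → lookup (triple x y z) i ∧ lookup s i) ≡⟨ count-triple-∧ x≢y x≢z y≢z (lookup s) ⟩
  toℕ (lookup s x) + toℕ (lookup s y) + toℕ (lookup s z) ∎
  where open ≡-Reasoning

∣triple∣ : {n : ℕ} {x y z : Fin n} → x ≢ y → x ≢ z → y ≢ z → ∣ triple x y z ∣ ≡ 3
∣triple∣ {x = x} {y} {z} x≢y x≢z y≢z = begin
  ∣ triple x y z ∣                          ≡⟨ ∣∣≡count (triple x y z) ⟩
  count (lookup (triple x y z))             ≡⟨ count-cong (λ i → ∧-identityʳ (lookup (triple x y z) i)) ⟨
  count (λ i → lookup (triple x y z) i ∧ true) ≡⟨ count-triple-∧ x≢y x≢z y≢z (const true) ⟩
  3                                         ∎
  where open ≡-Reasoning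

pair-extension : {n : ℕ} (s : Subset n) {x y : Fin n} → ∣ s ∣ ≡ 3 →
                 lookup s x ≡ true → lookup s y ≡ true → x ≢ y →
                 ∃[ d ] (d ≢ x × d ≢ y × s ≡ triple x y d)
pair-extension s {x} {y} ∣s∣≡3 x∈s y∈s x≢y = d , d≢x , d≢y , subset-ext same
  where
  open ≡-Reasoning
  s-x s-xy : Fin _ → Bool
  s-x i = lookup s i ∧ not (i == x)
  s-xy i = s-x i ∧ not (i == y)
  s-x∋y : s-x y ≡ true
  s-x∋y rewrite y∈s | ≢⇒==-false (≢-sym x≢y) = refl
  count-s-xy : count s-xy ≡ 1
  count-s-xy = suc-injective (suc-injective (begin
    suc (suc (count s-xy))   ≡⟨ cong suc (count-remove-true s-x s-x∋y) ⟨
    suc (count s-x)          ≡⟨ count-remove-true (lookup s) x∈s ⟨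
    count (lookup s)         ≡⟨ ∣∣≡count s ⟨
    ∣ s ∣                    ≡⟨ ∣s∣≡3 ⟩
    3                        ∎))
  witness = count>0⇒∃ s-xy (subst (0 <_) (sym count-s-xy) (s≤s z≤n))
  d = proj₁ witness
  d∈s-xy = proj₂ witness
  d∈s-x = proj₁ (∈-minus-point s-x d∈s-xy)
  d≢y = proj₂ (∈-minus-point s-x d∈s-xy)
  d≢x = proj₂ (∈-minus-point (lookup s) d∈s-x)
  same : ∀ i → lookup s i ≡ lookup (triple x y d) i
  same i with i ≟ x | i ≟ y
  ... | yes refl | _ = trans x∈s (sym (triple∋₁ x y d))
  ... | no _ | yes refl = trans y∈s (sym (triple∋₂ x y d))
  ... | no i≢x | no i≢y = begin
    lookup s i                          ≡⟨ ∧-identityʳ _ ⟨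
    lookup s i ∧ true                   ≡⟨ ∧-identityʳ _ ⟨
    (lookup s i ∧ true) ∧ true          ≡⟨ cong₂ (λ b c → (lookup s i ∧ not b) ∧ not c) (≢⇒==-false i≢x) (≢⇒==-false i≢y) ⟨
    s-xy i                              ≡⟨ count≡1⇒point s-xy d count-s-xy d∈s-xy i ⟩
    (i == d)                            ≡⟨ cong₂ (λ b c → (b ∨ c) ∨ (i == d)) (≢⇒==-false i≢x) (≢⇒==-false i≢y) ⟨
    ((i == x) ∨ (i == y)) ∨ (i == d)    ≡⟨ lookup-triple x y d i ⟨
    lookup (triple x y d) i             ∎

triple-view : {n : ℕ} (s : Subset n) → ∣ s ∣ ≡ 3 →
              ∃[ x ] ∃[ y ] ∃[ z ] (x ≢ y × x ≢ z × y ≢ z × s ≡ triple x y z)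
triple-view s ∣s∣≡3 = x , y , d , ≢-sym y≢x , ≢-sym d≢x , ≢-sym d≢y , s≡xyd
  where
  count-s≡3 : count (lookup s) ≡ 3
  count-s≡3 = trans (sym (∣∣≡count s)) ∣s∣≡3
  x-witness = count>0⇒∃ (lookup s) (subst (0 <_) (sym count-s≡3) (s≤s z≤n))
  x = proj₁ x-witness
  x∈s = proj₂ x-witness
  s-x : Fin _ → Bool
  s-x i = lookup s i ∧ not (i == x)
  count-s-x : count s-x ≡ 2
  count-s-x = suc-injective (trans (sym (count-remove-true (lookup s) x∈s)) count-s≡3)
  y-witness = count>0⇒∃ s-x (subst (0 <_) (sym count-s-x) (s≤s z≤n))
  y = proj₁ y-witness
  y∈s = proj₁ (∈-minus-point (lookup s) (proj₂ y-witness))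
  y≢x = proj₂ (∈-minus-point (lookup s) (proj₂ y-witness))
  extension = pair-extension s ∣s∣≡3 x∈s y∈s (≢-sym y≢x)
  d = proj₁ extension
  d≢x = proj₁ (proj₂ extension)
  d≢y = proj₁ (proj₂ (proj₂ extension))
  s≡xyd = proj₂ (proj₂ (proj₂ extension))

-- Counting subsets through their fibres

infix 4 _==ₛ_
_==ₛ_ : {n : ℕ} → Subset n → Subset n → Bool
s ==ₛ t = does (≡-dec Bool._≟_ s t)

==ₛ-refl : {n : ℕ} (s : Subset n) → (s ==ₛ s) ≡ true
==ₛ-refl s = dec-true (≡-dec Bool._≟_ s s) refl

==ₛ-false : {n : ℕ} {s t : Subset n} → s ≢ t → (s ==ₛ t) ≡ false
==ₛ-false {s = s} {t} = dec-false (≡-dec Bool._≟_ s t)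

sum-map-0 : {A : Set} (xs : List A) → sum (map (const 0) xs) ≡ 0
sum-map-0 [] = refl
sum-map-0 (x ∷ xs) = sum-map-0 xs

sum-map-+ : {A : Set} (h k : A → ℕ) (xs : List A) →
            sum (map (λ a → h a + k a) xs) ≡ sum (map h xs) + sum (map k xs)
sum-map-+ h k [] = refl
sum-map-+ h k (x ∷ xs) rewrite sum-map-+ h k xs = interchange (h x) (k x) (sum (map h xs)) (sum (map k xs))

length-filter≡sum : {A : Set} {P : Pred A 0ℓ} (P? : Decidable P) (h : A → ℕ) →
                    (∀ a → P a → h a ≡ 1) → (∀ a → ¬ P a → h a ≡ 0) →
                    (xs : List A) → length (filter P? xs) ≡ sum (map h xs)
length-filter≡sum P? h yes⇒1 no⇒0 [] = refl
length-filter≡sum P? h yes⇒1 no⇒0 (x ∷ xs) with P? x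
... | yes px rewrite yes⇒1 x px = cong suc (length-filter≡sum P? h yes⇒1 no⇒0 xs)
... | no ¬px rewrite no⇒0 x ¬px = length-filter≡sum P? h yes⇒1 no⇒0 xs

sumSubsets : (n : ℕ) → (Subset n → ℕ) → ℕ
sumSubsets n h = sum (map h (allSubsets n))

sumSubsets-suc : (n : ℕ) (h : Subset (suc n) → ℕ) →
                 sumSubsets (suc n) h ≡ sumSubsets n (h ∘ (true ∷_)) + sumSubsets n (h ∘ (false ∷_))
sumSubsets-suc n h = begin
  sum (map h (map (true ∷_) A ++ map (false ∷_) A))          ≡⟨ cong sum (map-++ h (map (true ∷_) A) _) ⟩
  sum (map h (map (true ∷_) A) ++ map h (map (false ∷_) A))  ≡⟨ sum-++ (map h (map (true ∷_) A)) _ ⟩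
  sum (map h (map (true ∷_) A)) + sum (map h (map (false ∷_) A))
    ≡⟨ cong₂ (λ l r → sum l + sum r) (map-∘ A) (map-∘ A) ⟨
  sumSubsets n (h ∘ (true ∷_)) + sumSubsets n (h ∘ (false ∷_)) ∎
  where
  open ≡-Reasoning
  A = allSubsets n

sumSubsets-indicator : {n : ℕ} (t : Subset n) → sumSubsets n (λ s → toℕ (t ==ₛ s)) ≡ 1
sumSubsets-indicator {zero} [] = refl
sumSubsets-indicator {suc n} (true ∷ t) rewrite sumSubsets-suc n (λ s → toℕ ((true ∷ t) ==ₛ s))
  | sumSubsets-indicator t | sum-map-0 (allSubsets n) = refl
sumSubsets-indicator {suc n} (false ∷ t) rewrite sumSubsets-suc n (λ s → toℕ ((false ∷ t) ==ₛ s))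
  | sumSubsets-indicator t | sum-map-0 (allSubsets n) = refl

sumSubsets-fibres : {n k : ℕ} (g : Fin k → Bool) (e : Fin k → Subset n) →
                    sumSubsets n (λ s → count (λ d → g d ∧ (e d ==ₛ s))) ≡ count g
sumSubsets-fibres {n} {zero} g e = sum-map-0 (allSubsets n)
sumSubsets-fibres {n} {suc k} g e = begin
  sumSubsets n (λ s → toℕ (g zero ∧ (e zero ==ₛ s)) + count (λ d → g (suc d) ∧ (e (suc d) ==ₛ s)))
    ≡⟨ sum-map-+ _ _ (allSubsets n) ⟩
  sumSubsets n (λ s → toℕ (g zero ∧ (e zero ==ₛ s))) + sumSubsets n (λ s → count (λ d → g (suc d) ∧ (e (suc d) ==ₛ s)))
    ≡⟨ cong₂ _+_ (head (g zero)) (sumSubsets-fibres (g ∘ suc) (e ∘ suc)) ⟩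
  count g ∎
  where
  open ≡-Reasoning
  head : ∀ b → sumSubsets n (λ s → toℕ (b ∧ (e zero ==ₛ s))) ≡ toℕ b
  head true = sumSubsets-indicator (e zero)
  head false = sum-map-0 (allSubsets n)

module _ {n : ℕ} (x y : Fin n) where

  pairFibre : (Fin n → Bool) → Subset n → ℕ
  pairFibre H s = count (λ d → H d ∧ (triple x y d ==ₛ s))

  pairFibre-triple : (H : Fin n → Bool) → (∀ d → H d ≡ true → d ≢ x × d ≢ y) →
                     {d₀ : Fin n} → d₀ ≢ x → d₀ ≢ y → pairFibre H (triple x y d₀) ≡ toℕ (H d₀)
  pairFibre-triple H excl {d₀} d₀≢x d₀≢y = begin
    pairFibre H (triple x y d₀)                         ≡⟨ count-supported _ d₀ off-d₀ ⟩
    toℕ (H d₀ ∧ (triple x y d₀ ==ₛ triple x y d₀))      ≡⟨ cong (λ b → toℕ (H d₀ ∧ b)) (==ₛ-refl (triple x y d₀)) ⟩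
    toℕ (H d₀ ∧ true)                                   ≡⟨ cong toℕ (∧-identityʳ (H d₀)) ⟩
    toℕ (H d₀)                                          ∎
    where
    open ≡-Reasoning
    off-d₀ : ∀ d → d ≢ d₀ → H d ∧ (triple x y d ==ₛ triple x y d₀) ≡ false
    off-d₀ d d≢d₀ with H d in Hd
    ... | false = refl
    ... | true  = ==ₛ-false (d≢d₀ ∘ triple-injective₃ (proj₁ (excl d Hd)) (proj₂ (excl d Hd)))

  pairFibre-≡0 : (H : Fin n → Bool) {s : Subset n} → (∀ d → H d ≡ true → triple x y d ≢ s) → pairFibre H s ≡ 0
  pairFibre-≡0 H {s} avoid = count-false _ none
    where
    none : ∀ d → H d ∧ (triple x y d ==ₛ s) ≡ false
    none d with H d in Hd
    ... | false = refl
    ... | true  = ==ₛ-false (avoid d Hd)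

  pairFibre-∌₁ : (H : Fin n → Bool) {s : Subset n} → lookup s x ≡ false → pairFibre H s ≡ 0
  pairFibre-∌₁ H s∌x = pairFibre-≡0 H λ { d _ refl → contradiction (trans (sym (triple∋₁ x y d)) s∌x) λ () }

  pairFibre-∌₂ : (H : Fin n → Bool) {s : Subset n} → lookup s y ≡ false → pairFibre H s ≡ 0
  pairFibre-∌₂ H s∌y = pairFibre-≡0 H λ { d _ refl → contradiction (trans (sym (triple∋₂ x y d)) s∌y) λ () }

-- Codegrees in J(n,3)

6≤⇒≰2 : ∀ {m} → 6 ≤ m → ¬ m ≤ 2
6≤⇒≰2 6≤m m≤2 = contradiction (≤-trans 6≤m m≤2) λ { (s≤s (s≤s ())) }

xor≡false⇒≡ : {p q : Bool} → p xor q ≡ false → p ≡ q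
xor≡false⇒≡ {true}  {true}  _ = refl
xor≡false⇒≡ {false} {false} _ = refl

n∸4≡3+n∸7 : {n : ℕ} → 7 ≤ n → n ∸ 4 ≡ 3 + (n ∸ 7)
n∸4≡3+n∸7 (s≤s (s≤s (s≤s (s≤s 3≤m)))) = sym (m+[n∸m]≡n 3≤m)

data Profile : Bool → Bool → Bool → Set where
  ttt : Profile true true true
  ttf : Profile true true false
  fff : Profile false false false

profile-ac≡ab : {x y z : Bool} → Profile x y z → y ≡ x
profile-ac≡ab ttt = refl
profile-ac≡ab ttf = refl
profile-ac≡ab fff = refl

profile-bc⇒ab : {x y z : Bool} → Profile x y z → z ≡ true → x ≡ true
profile-bc⇒ab ttt _ = refl

profile-ab⇒bc : {x y z : Bool} → Profile x y z → x ≡ false → z ≡ false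
profile-ab⇒bc fff _ = refl

profile-from-triple : {x y z : Bool} → let xyz : Bool × Bool × Bool; xyz = (x , y , z) in
                      (xyz ≡ (true , true , true)) ⊎ (xyz ≡ (true , true , false)) ⊎ (xyz ≡ (false , false , false)) →
                      Profile x y z
profile-from-triple (inj₁ refl) = ttt
profile-from-triple (inj₂ (inj₁ refl)) = ttf
profile-from-triple (inj₂ (inj₂ refl)) = fff

module Codegrees {n : ℕ} (χ : Subset n → Bool) where

  χ₃ : Fin n → Fin n → Fin n → Bool
  χ₃ x y z = χ (triple x y z)

  χ₃-comm₁₂ : (x y z : Fin n) → χ₃ x y z ≡ χ₃ y x z
  χ₃-comm₁₂ x y z = cong χ (triple-comm₁₂ x y z)

  χ₃-comm₂₃ : (x y z : Fin n) → χ₃ x y z ≡ χ₃ x z y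
  χ₃-comm₂₃ x y z = cong χ (triple-comm₂₃ x y z)

  χ₃-rotate : (x y z : Fin n) → χ₃ x y z ≡ χ₃ y z x
  χ₃-rotate x y z = cong χ (triple-rotate x y z)

  awayFrom : Fin n → Fin n → Fin n → Bool
  awayFrom x y d = not ((d == x) ∨ (d == y))

  codegree : Fin n → Fin n → ℕ
  codegree x y = count (λ d → awayFrom x y d ∧ χ₃ x y d)

  awayFrom-true : {x y d : Fin n} → awayFrom x y d ≡ true → d ≢ x × d ≢ y
  awayFrom-true {x} {y} {d} e with d ≟ x | d ≟ y
  ... | no d≢x | no d≢y = d≢x , d≢y

  awayFrom-≢ : {x y d : Fin n} → d ≢ x → d ≢ y → awayFrom x y d ≡ true
  awayFrom-≢ d≢x d≢y rewrite ≢⇒==-false d≢x | ≢⇒==-false d≢y = refl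

  count-awayFrom : {x y : Fin n} → x ≢ y → count (awayFrom x y) + 2 ≡ n
  count-awayFrom {x} {y} x≢y = begin
    count (awayFrom x y) + 2                                       ≡⟨ +-comm _ 2 ⟩
    2 + count (awayFrom x y)                                       ≡⟨ cong (_+ count (awayFrom x y)) (count-pair x≢y) ⟨
    count (λ i → (i == x) ∨ (i == y)) + count (awayFrom x y)      ≡⟨ count-complement _ ⟩
    n                                                              ∎
    where open ≡-Reasoning

  codegree-sym : (x y : Fin n) → codegree x y ≡ codegree y x
  codegree-sym x y = count-cong λ d → cong₂ (λ a b → not a ∧ b) (∨-comm (d == x) (d == y)) (χ₃-comm₁₂ x y d)

  codegree+2≤n : {x y : Fin n} → x ≢ y → codegree x y + 2 ≤ n
  codegree+2≤n {x} {y} x≢y =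
    ≤-trans (+-monoˡ-≤ 2 (count-mono _ (awayFrom x y) λ d → ∧-conicalˡ _ _)) (≤-reflexive (count-awayFrom x≢y))

  codegree+2≡n⇒χ₃ : {x y : Fin n} → x ≢ y → codegree x y + 2 ≡ n → ∀ e → e ≢ x → e ≢ y → χ₃ x y e ≡ true
  codegree+2≡n⇒χ₃ {x} {y} x≢y full e e≢x e≢y = ∧-conicalʳ _ _
    (count-≡⇒⊇ _ (awayFrom x y) (λ d → ∧-conicalˡ _ _)
      (+-cancelʳ-≡ 2 _ _ (trans full (sym (count-awayFrom x≢y)))) e (awayFrom-≢ e≢x e≢y))

  codegree≡0 : {x y : Fin n} → (∀ e → e ≢ x → e ≢ y → χ₃ x y e ≡ false) → codegree x y ≡ 0
  codegree≡0 {x} {y} none = count-false _ off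
    where
    off : ∀ d → awayFrom x y d ∧ χ₃ x y d ≡ false
    off d with d ≟ x | d ≟ y
    ... | yes _  | _      = refl
    ... | no _   | yes _  = refl
    ... | no d≢x | no d≢y = none d d≢x d≢y

  pairCount≡codegree : {x y : Fin n} → x ≢ y → pairCount χ x y ≡ codegree x y
  pairCount≡codegree {x} {y} x≢y = begin
    pairCount χ x y                  ≡⟨ length-filter≡sum _ (pairFibre x y G) contains⇒1 ¬contains⇒0 (allSubsets n) ⟩
    sumSubsets n (pairFibre x y G)   ≡⟨ sumSubsets-fibres G (triple x y) ⟩
    codegree x y                     ∎
    where
    open ≡-Reasoning
    G : Fin n → Bool
    G d = awayFrom x y d ∧ χ₃ x y d
    ContainsPair : Subset n → Set
    ContainsPair s = (∣ s ∣ ≡ 3) × (x ∈ s) × (y ∈ s) × (χ s ≡ true)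
    contains⇒1 : ∀ s → ContainsPair s → pairFibre x y G s ≡ 1
    contains⇒1 s (∣s∣≡3 , x∈s , y∈s , χs) with pair-extension s ∣s∣≡3 ([]=⇒lookup x∈s) ([]=⇒lookup y∈s) x≢y
    ... | d₀ , d₀≢x , d₀≢y , refl
      rewrite pairFibre-triple x y G (λ d → awayFrom-true ∘ ∧-conicalˡ _ _) d₀≢x d₀≢y
            | awayFrom-≢ d₀≢x d₀≢y | χs = refl
    ¬contains⇒0 : ∀ s → ¬ ContainsPair s → pairFibre x y G s ≡ 0
    ¬contains⇒0 s ¬contains = pairFibre-≡0 x y G λ d Gd → λ { refl →
      let d≢x , d≢y = awayFrom-true (∧-conicalˡ _ _ Gd) in
      ¬contains (∣triple∣ x≢y (≢-sym d≢x) (≢-sym d≢y) ,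
                 lookup⇒[]= x _ (triple∋₁ x y d) , lookup⇒[]= y _ (triple∋₂ x y d) , ∧-conicalʳ _ _ Gd) }

  outsideχ : Subset n → Fin n → Fin n → Fin n → Bool
  outsideχ T x y d = not (lookup T d) ∧ χ₃ x y d

  outsideCodegree : Subset n → Fin n → Fin n → ℕ
  outsideCodegree T x y = count (outsideχ T x y)

  codegree-split : {T : Subset n} {x y z : Fin n} → T ≡ triple x y z → x ≢ y → x ≢ z → y ≢ z →
                   codegree x y ≡ toℕ (χ₃ x y z) + outsideCodegree T x y
  codegree-split {x = x} {y} {z} refl x≢y x≢z y≢z = begin
    codegree x y                                                                   ≡⟨ count-remove _ z ⟩
    toℕ (awayFrom x y z ∧ χ₃ x y z) + count (λ d → (awayFrom x y d ∧ χ₃ x y d) ∧ not (d == z))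
      ≡⟨ cong₂ _+_ (cong (λ b → toℕ (b ∧ χ₃ x y z)) (awayFrom-≢ (≢-sym x≢z) (≢-sym y≢z))) (count-cong outside) ⟩
    toℕ (χ₃ x y z) + outsideCodegree (triple x y z) x y                            ∎
    where
    open ≡-Reasoning
    outside : ∀ d → (awayFrom x y d ∧ χ₃ x y d) ∧ not (d == z) ≡ outsideχ (triple x y z) x y d
    outside d rewrite lookup-triple x y z d with d == x | d == y | d == z
    ... | true  | _     | _     = refl
    ... | false | true  | _     = refl
    ... | false | false | true  = ∧-zeroʳ _
    ... | false | false | false = ∧-identityʳ _

  NeighbourInX₁ : Subset n → Subset n → Set
  NeighbourInX₁ T s = (∣ s ∣ ≡ 3) × (∣ T ∩ s ∣ ≡ 2) × (χ s ≡ true)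

  outsideχ-true : {T : Subset n} {p q r d : Fin n} → T ≡ triple p q r → outsideχ T p q d ≡ true →
                  d ≢ p × d ≢ q × d ≢ r
  outsideχ-true refl e = triple∌⇒≢ (not-injective (∧-conicalˡ _ _ e))

  neighbour-via-pair : {T : Subset n} {p q r : Fin n} → T ≡ triple p q r → p ≢ q → p ≢ r → q ≢ r →
                       ∀ {d} → outsideχ T p q d ≡ true → NeighbourInX₁ T (triple p q d)
  neighbour-via-pair {p = p} {q} {r} refl p≢q p≢r q≢r {d} e =
    ∣triple∣ p≢q (≢-sym d≢p) (≢-sym d≢q) , ∣T∩extension∣ , ∧-conicalʳ _ _ e
    where
    d≢p,q,r = outsideχ-true refl e
    d≢p = proj₁ d≢p,q,r
    d≢q = proj₁ (proj₂ d≢p,q,r)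
    d≢r = proj₂ (proj₂ d≢p,q,r)
    ∣T∩extension∣ : ∣ triple p q r ∩ triple p q d ∣ ≡ 2
    ∣T∩extension∣ rewrite ∣triple∩∣ p≢q p≢r q≢r (triple p q d) | triple∋₁ p q d | triple∋₂ p q d
                        | triple∌ p q d (≢-sym p≢r) (≢-sym q≢r) (≢-sym d≢r) = refl

  pairFibre-neighbour : {T : Subset n} {p q r : Fin n} → T ≡ triple p q r → p ≢ q → {s : Subset n} →
                        ∣ s ∣ ≡ 3 → χ s ≡ true → lookup s p ≡ true → lookup s q ≡ true → lookup s r ≡ false →
                        pairFibre p q (outsideχ T p q) s ≡ 1
  pairFibre-neighbour {p = p} {q} {r} refl p≢q {s} ∣s∣≡3 χs s∋p s∋q s∌r with pair-extension s ∣s∣≡3 s∋p s∋q p≢q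
  ... | d₀ , d₀≢p , d₀≢q , refl
    rewrite pairFibre-triple p q (outsideχ (triple p q r) p q)
              (λ d e → let d≢p , d≢q , _ = outsideχ-true refl e in d≢p , d≢q) d₀≢p d₀≢q
          | triple∌ p q r d₀≢p d₀≢q (λ { refl → contradiction (trans (sym (triple∋₃ p q d₀)) s∌r) λ () })
          | χs = refl

  neighboursIn-triple : {x y z : Fin n} → x ≢ y → x ≢ z → y ≢ z →
                        neighboursIn χ (triple x y z) true ≡
                        outsideCodegree (triple x y z) x y + outsideCodegree (triple x y z) x z
                          + outsideCodegree (triple x y z) y z
  neighboursIn-triple {x} {y} {z} x≢y x≢z y≢z = begin
    neighboursIn χ T true
      ≡⟨ length-filter≡sum _ (λ s → fibre-xy s + fibre-xz s + fibre-yz s) neighbour⇒1 ¬neighbour⇒0 (allSubsets n) ⟩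
    sumSubsets n (λ s → fibre-xy s + fibre-xz s + fibre-yz s)
      ≡⟨ sum-map-+ (λ s → fibre-xy s + fibre-xz s) fibre-yz (allSubsets n) ⟩
    sumSubsets n (λ s → fibre-xy s + fibre-xz s) + sumSubsets n fibre-yz
      ≡⟨ cong (_+ sumSubsets n fibre-yz) (sum-map-+ fibre-xy fibre-xz (allSubsets n)) ⟩
    sumSubsets n fibre-xy + sumSubsets n fibre-xz + sumSubsets n fibre-yz
      ≡⟨ cong₂ _+_ (cong₂ _+_ (sumSubsets-fibres _ (triple x y)) (sumSubsets-fibres _ (triple x z)))
                   (sumSubsets-fibres _ (triple y z)) ⟩
    outsideCodegree T x y + outsideCodegree T x z + outsideCodegree T y z ∎
    where
    open ≡-Reasoning
    T = triple x y z
    fibre-xy fibre-xz fibre-yz : Subset n → ℕ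
    fibre-xy = pairFibre x y (outsideχ T x y)
    fibre-xz = pairFibre x z (outsideχ T x z)
    fibre-yz = pairFibre y z (outsideχ T y z)
    T≡xzy : T ≡ triple x z y
    T≡xzy = triple-comm₂₃ x y z
    T≡yzx : T ≡ triple y z x
    T≡yzx = triple-rotate x y z
    sum₃ : ∀ {s i j k} → fibre-xy s ≡ i → fibre-xz s ≡ j → fibre-yz s ≡ k →
           fibre-xy s + fibre-xz s + fibre-yz s ≡ i + j + k
    sum₃ p q r = cong₂ _+_ (cong₂ _+_ p q) r
    neighbour⇒1 : ∀ s → NeighbourInX₁ T s → fibre-xy s + fibre-xz s + fibre-yz s ≡ 1
    neighbour⇒1 s (∣s∣≡3 , ∣T∩s∣≡2 , χs) =
      by-membership _ _ _ refl refl refl (trans (sym (∣triple∩∣ x≢y x≢z y≢z s)) ∣T∩s∣≡2)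
      where
      by-membership : ∀ a b c → lookup s x ≡ a → lookup s y ≡ b → lookup s z ≡ c →
                      toℕ a + toℕ b + toℕ c ≡ 2 → fibre-xy s + fibre-xz s + fibre-yz s ≡ 1
      by-membership true true false s∋x s∋y s∌z _ = sum₃
        (pairFibre-neighbour refl x≢y ∣s∣≡3 χs s∋x s∋y s∌z)
        (pairFibre-∌₂ x z (outsideχ T x z) s∌z) (pairFibre-∌₂ y z (outsideχ T y z) s∌z)
      by-membership true false true s∋x s∌y s∋z _ = sum₃
        (pairFibre-∌₂ x y (outsideχ T x y) s∌y)
        (pairFibre-neighbour T≡xzy x≢z ∣s∣≡3 χs s∋x s∋z s∌y) (pairFibre-∌₁ y z (outsideχ T y z) s∌y)
      by-membership false true true s∌x s∋y s∋z _ = sum₃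
        (pairFibre-∌₁ x y (outsideχ T x y) s∌x) (pairFibre-∌₁ x z (outsideχ T x z) s∌x)
        (pairFibre-neighbour T≡yzx y≢z ∣s∣≡3 χs s∋y s∋z s∌x)
      by-membership true  true  true  _ _ _ ()
      by-membership true  false false _ _ _ ()
      by-membership false true  false _ _ _ ()
      by-membership false false true  _ _ _ ()
      by-membership false false false _ _ _ ()
    ¬neighbour⇒0 : ∀ s → ¬ NeighbourInX₁ T s → fibre-xy s + fibre-xz s + fibre-yz s ≡ 0
    ¬neighbour⇒0 s ¬nb = sum₃
      (pairFibre-≡0 x y (outsideχ T x y) λ d e → λ { refl → ¬nb (neighbour-via-pair refl x≢y x≢z y≢z e) })
      (pairFibre-≡0 x z (outsideχ T x z) λ d e → λ { refl → ¬nb (neighbour-via-pair T≡xzy x≢z x≢y (≢-sym y≢z) e) })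
      (pairFibre-≡0 y z (outsideχ T y z) λ d e → λ { refl → ¬nb (neighbour-via-pair T≡yzx y≢z (≢-sym x≢y) (≢-sym x≢z) e) })

  codegree-triangle : {x y z : Fin n} → x ≢ y → x ≢ z → y ≢ z →
                      codegree x y + codegree x z + codegree y z ≡ 3 * toℕ (χ₃ x y z) + neighboursIn χ (triple x y z) true
  codegree-triangle {x} {y} {z} x≢y x≢z y≢z = begin
    codegree x y + codegree x z + codegree y z
      ≡⟨ cong₂ _+_ (cong₂ _+_ (codegree-split refl x≢y x≢z y≢z)
                              (codegree-split (triple-comm₂₃ x y z) x≢z x≢y (≢-sym y≢z)))
                   (codegree-split (triple-rotate x y z) y≢z (≢-sym x≢y) (≢-sym x≢z)) ⟩
    toℕ (χ₃ x y z) + O-xy + (toℕ (χ₃ x z y) + O-xz) + (toℕ (χ₃ y z x) + O-yz)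
      ≡⟨ cong₂ (λ b c → toℕ (χ₃ x y z) + O-xy + (toℕ b + O-xz) + (toℕ c + O-yz))
               (χ₃-comm₂₃ x y z) (χ₃-rotate x y z) ⟨
    toℕ (χ₃ x y z) + O-xy + (toℕ (χ₃ x y z) + O-xz) + (toℕ (χ₃ x y z) + O-yz)
      ≡⟨ regroup (toℕ (χ₃ x y z)) O-xy O-xz O-yz ⟩
    3 * toℕ (χ₃ x y z) + (O-xy + O-xz + O-yz)
      ≡⟨ cong (3 * toℕ (χ₃ x y z) +_) (neighboursIn-triple x≢y x≢z y≢z) ⟨
    3 * toℕ (χ₃ x y z) + neighboursIn χ (triple x y z) true ∎
    where
    open ≡-Reasoning
    O-xy = outsideCodegree (triple x y z) x y
    O-xz = outsideCodegree (triple x y z) x z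
    O-yz = outsideCodegree (triple x y z) y z
    regroup : ∀ c a b d → c + a + (c + b) + (c + d) ≡ 3 * c + (a + b + d)
    regroup = solve-∀

  triangle-λ₂ : {p : Fin 2 → Fin 2 → ℕ} → IsEquitableWith n χ p → p zero zero ≡ p (suc zero) zero + (n ∸ 7) →
                7 ≤ n → {x y z : Fin n} → x ≢ y → x ≢ z → y ≢ z →
                codegree x y + codegree x z + codegree y z ≡ p (suc zero) zero + toℕ (χ₃ x y z) * (n ∸ 4)
  triangle-λ₂ {p} (_ , equitable) λ₂ 7≤n {x} {y} {z} x≢y x≢z y≢z =
    trans (codegree-triangle x≢y x≢z y≢z) (by-colour (χ₃ x y z) refl)
    where
    open ≡-Reasoning
    p₁₀ = p (suc zero) zero
    shuffle : ∀ q m → 3 + (q + m) ≡ q + ((3 + m) + 0)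
    shuffle = solve-∀
    by-colour : ∀ b → χ₃ x y z ≡ b → 3 * toℕ b + neighboursIn χ (triple x y z) true ≡ p₁₀ + toℕ b * (n ∸ 4)
    by-colour true xyz∈ = begin
      3 + neighboursIn χ (triple x y z) true   ≡⟨ cong (3 +_) (equitable zero zero _ (∣triple∣ x≢y x≢z y≢z) xyz∈) ⟩
      3 + p zero zero                          ≡⟨ cong (3 +_) λ₂ ⟩
      3 + (p₁₀ + (n ∸ 7))                      ≡⟨ shuffle p₁₀ (n ∸ 7) ⟩
      p₁₀ + (3 + (n ∸ 7) + 0)                  ≡⟨ cong (λ m → p₁₀ + (m + 0)) (n∸4≡3+n∸7 7≤n) ⟨
      p₁₀ + 1 * (n ∸ 4)                        ∎
    by-colour false xyz∉ = trans (equitable (suc zero) zero _ (∣triple∣ x≢y x≢z y≢z) xyz∉) (sym (+-identityʳ p₁₀))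

  module Configuration (P : ℕ)
    (triangle : ∀ {x y z} → x ≢ y → x ≢ z → y ≢ z →
                codegree x y + codegree x z + codegree y z ≡ P + toℕ (χ₃ x y z) * (n ∸ 4))
    (n>14 : n > 14)
    {a b c : Fin n} (a≢b : a ≢ b) (a≢c : a ≢ c) (b≢c : b ≢ c) (abc∈X₁ : χ₃ a b c ≡ true)
    (codegree-gap : 2 * codegree a c ≡ 2 * codegree b c + (n ∸ 4))
    (profile : ∀ {d} → d ≢ a → d ≢ b → d ≢ c → Profile (χ₃ a b d) (χ₃ a c d) (χ₃ b c d))
    where

    outside : Fin n → Bool
    outside d = not (lookup (triple a b c) d)

    outside⇒≢ : ∀ {d} → outside d ≡ true → d ≢ a × d ≢ b × d ≢ c
    outside⇒≢ o = triple∌⇒≢ (not-injective o)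

    profile-outside : ∀ {d} → outside d ≡ true → Profile (χ₃ a b d) (χ₃ a c d) (χ₃ b c d)
    profile-outside o = let d≢a , d≢b , d≢c = outside⇒≢ o in profile d≢a d≢b d≢c

    -- Matching on this view, unlike on x ≟ b, leaves the tests inside side x untouched.
    data Point (x : Fin n) : Set where
      is-a : x ≡ a → Point x
      is-b : x ≡ b → Point x
      is-c : x ≡ c → Point x
      is-outside : outside x ≡ true → Point x

    point : ∀ x → Point x
    point x with x ≟ a | x ≟ b | x ≟ c
    ... | yes x≡a | _       | _       = is-a x≡a
    ... | no _    | yes x≡b | _       = is-b x≡b
    ... | no _    | no _    | yes x≡c = is-c x≡c
    ... | no x≢a  | no x≢b  | no x≢c  = is-outside (cong not (triple∌ a b c x≢a x≢b x≢c))

    k β γ : ℕ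
    k = count (λ d → outside d ∧ χ₃ b c d)
    β = count (λ d → outside d ∧ (χ₃ a b d ∧ not (χ₃ b c d)))
    γ = count (λ d → outside d ∧ not (χ₃ a b d))

    count-outside-ab : count (λ d → outside d ∧ χ₃ a b d) ≡ k + β
    count-outside-ab = trans (count-split _ (χ₃ b c))
                             (cong₂ _+_ (count-cong bc∈) (count-cong λ d → ∧-assoc (outside d) _ _))
      where
      bc∈ : ∀ d → (outside d ∧ χ₃ a b d) ∧ χ₃ b c d ≡ outside d ∧ χ₃ b c d
      bc∈ d with outside d in o | χ₃ b c d in bcd
      ... | false | _     = refl
      ... | true  | false = ∧-zeroʳ _
      ... | true  | true  = cong (_∧ true) (profile-bc⇒ab (profile-outside o) bcd)

    codegree-ab : codegree a b ≡ suc (k + β)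
    codegree-ab = trans (codegree-split refl a≢b a≢c b≢c) (cong₂ _+_ (cong toℕ abc∈X₁) count-outside-ab)

    codegree-ac : codegree a c ≡ suc (k + β)
    codegree-ac = trans (codegree-split (triple-comm₂₃ a b c) a≢c a≢b (≢-sym b≢c))
      (cong₂ _+_ (cong toℕ (trans (sym (χ₃-comm₂₃ a b c)) abc∈X₁)) (trans (count-cong ac-as-ab) count-outside-ab))
      where
      ac-as-ab : ∀ d → outside d ∧ χ₃ a c d ≡ outside d ∧ χ₃ a b d
      ac-as-ab d with outside d in o
      ... | false = refl
      ... | true  = profile-ac≡ab (profile-outside o)

    codegree-bc : codegree b c ≡ suc k
    codegree-bc = trans (codegree-split (triple-rotate a b c) b≢c (≢-sym a≢b) (≢-sym a≢c))
                        (cong (_+ k) (cong toℕ (trans (sym (χ₃-rotate a b c)) abc∈X₁)))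

    n≡3+k+β+γ : n ≡ 3 + (k + β + γ)
    n≡3+k+β+γ = begin
      n                                                    ≡⟨ count-complement (lookup (triple a b c)) ⟨
      count (lookup (triple a b c)) + count outside        ≡⟨ cong₂ _+_ ∣abc∣ (count-split outside (χ₃ a b)) ⟩
      3 + (count (λ d → outside d ∧ χ₃ a b d) + γ)         ≡⟨ cong (λ m → 3 + (m + γ)) count-outside-ab ⟩
      3 + (k + β + γ)                                      ∎
      where
      open ≡-Reasoning
      ∣abc∣ : count (lookup (triple a b c)) ≡ 3
      ∣abc∣ = trans (sym (∣∣≡count (triple a b c))) (∣triple∣ a≢b a≢c b≢c)

    s : ℕ
    s = suc k

    n∸4≡2β : n ∸ 4 ≡ β + β
    n∸4≡2β = +-cancelˡ-≡ (2 * s) (n ∸ 4) (β + β) (begin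
      2 * s + (n ∸ 4)              ≡⟨ cong (λ g → 2 * g + (n ∸ 4)) codegree-bc ⟨
      2 * codegree b c + (n ∸ 4)   ≡⟨ codegree-gap ⟨
      2 * codegree a c             ≡⟨ cong (2 *_) codegree-ac ⟩
      2 * (s + β)                  ≡⟨ regroup s β ⟩
      2 * s + (β + β)              ∎)
      where
      open ≡-Reasoning
      regroup : ∀ s β → 2 * (s + β) ≡ 2 * s + (β + β)
      regroup = solve-∀

    n≡2β+4 : n ≡ β + β + 4
    n≡2β+4 = trans (sym (m∸n+n≡m (≤-trans (m≤m+n 4 11) n>14))) (cong (_+ 4) n∸4≡2β)

    6≤β : 6 ≤ β
    6≤β with 6 ≤? β
    ... | yes 6≤β = 6≤β
    ... | no 6≰β = contradiction (subst (14 <_) n≡2β+4 n>14) (≤⇒≯ (+-monoˡ-≤ 4 (+-mono-≤ β≤5 β≤5)))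
      where
      β≤5 : β ≤ 5
      β≤5 = ≤-pred (≰⇒> 6≰β)

    P≡3s : P ≡ 3 * s
    P≡3s = +-cancelʳ-≡ (β + β) P (3 * s) (begin
      P + (β + β)                                  ≡⟨ cong (P +_) (*-identityˡ (β + β)) ⟨
      P + 1 * (β + β)                              ≡⟨ cong₂ (λ t N → P + toℕ t * N) abc∈X₁ n∸4≡2β ⟨
      P + toℕ (χ₃ a b c) * (n ∸ 4)                 ≡⟨ triangle a≢b a≢c b≢c ⟨
      codegree a b + codegree a c + codegree b c   ≡⟨ cong₂ _+_ (cong₂ _+_ codegree-ab codegree-ac) codegree-bc ⟩
      s + β + (s + β) + s                          ≡⟨ regroup s β ⟩
      3 * s + (β + β)                              ∎)
      where
      open ≡-Reasoning
      regroup : ∀ s β → s + β + (s + β) + s ≡ 3 * s + (β + β)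
      regroup = solve-∀

    bonus : Bool → ℕ
    bonus t = toℕ t * β

    bonus-true : bonus true ≡ β
    bonus-true = +-identityʳ β

    bonus≤β : ∀ t → bonus t ≤ β
    bonus≤β true  = ≤-reflexive bonus-true
    bonus≤β false = z≤n

    bonus-complement : ∀ t → bonus t + bonus (not t) ≡ β
    bonus-complement true  = trans (+-identityʳ _) bonus-true
    bonus-complement false = bonus-true

    law : ∀ {x y z} → x ≢ y → x ≢ z → y ≢ z →
          codegree x y + codegree x z + codegree y z ≡ 3 * s + 2 * bonus (χ₃ x y z)
    law {x} {y} {z} x≢y x≢z y≢z = begin
      codegree x y + codegree x z + codegree y z   ≡⟨ triangle x≢y x≢z y≢z ⟩
      P + toℕ (χ₃ x y z) * (n ∸ 4)                 ≡⟨ cong₂ (λ p N → p + toℕ (χ₃ x y z) * N) P≡3s n∸4≡2β ⟩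
      3 * s + toℕ (χ₃ x y z) * (β + β)             ≡⟨ cong (3 * s +_) (distrib (toℕ (χ₃ x y z)) β) ⟩
      3 * s + 2 * bonus (χ₃ x y z)                 ∎
      where
      open ≡-Reasoning
      distrib : ∀ t β → t * (β + β) ≡ 2 * (t * β)
      distrib = solve-∀

    codegree-bd≡cd : ∀ {d} → outside d ≡ true → codegree b d ≡ codegree c d
    codegree-bd≡cd {d} o = +-cancelˡ-≡ (codegree a b + codegree a d) _ _ (begin
      codegree a b + codegree a d + codegree b d   ≡⟨ law a≢b (≢-sym d≢a) (≢-sym d≢b) ⟩
      3 * s + 2 * bonus (χ₃ a b d)                 ≡⟨ cong (λ t → 3 * s + 2 * bonus t) (profile-ac≡ab (profile-outside o)) ⟨
      3 * s + 2 * bonus (χ₃ a c d)                 ≡⟨ law a≢c (≢-sym d≢a) (≢-sym d≢c) ⟨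
      codegree a c + codegree a d + codegree c d   ≡⟨ cong (λ g → g + codegree a d + codegree c d) (trans codegree-ac (sym codegree-ab)) ⟩
      codegree a b + codegree a d + codegree c d   ∎)
      where
      open ≡-Reasoning
      d≢a = proj₁ (outside⇒≢ o)
      d≢b = proj₁ (proj₂ (outside⇒≢ o))
      d≢c = proj₂ (proj₂ (outside⇒≢ o))

    codegree-bd : ∀ {d} → outside d ≡ true → codegree b d ≡ s + bonus (χ₃ b c d)
    codegree-bd {d} o = *-cancelˡ-≡ (codegree b d) (s + bonus (χ₃ b c d)) 2 (+-cancelˡ-≡ s _ _ (begin
      s + 2 * codegree b d                          ≡⟨ regroupˡ s (codegree b d) ⟩
      s + codegree b d + codegree b d               ≡⟨ cong₂ (λ g z → g + codegree b d + z) codegree-bc (sym (codegree-bd≡cd o)) ⟨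
      codegree b c + codegree b d + codegree c d    ≡⟨ law b≢c (≢-sym d≢b) (≢-sym d≢c) ⟩
      3 * s + 2 * bonus (χ₃ b c d)                  ≡⟨ regroupʳ s (bonus (χ₃ b c d)) ⟩
      s + 2 * (s + bonus (χ₃ b c d))                ∎))
      where
      open ≡-Reasoning
      d≢b = proj₁ (proj₂ (outside⇒≢ o))
      d≢c = proj₂ (proj₂ (outside⇒≢ o))
      regroupˡ : ∀ s y → s + 2 * y ≡ s + y + y
      regroupˡ = solve-∀
      regroupʳ : ∀ s t → 3 * s + 2 * t ≡ s + 2 * (s + t)
      regroupʳ = solve-∀

    codegree-ad : ∀ {d} → outside d ≡ true → codegree a d + β + bonus (χ₃ b c d) ≡ s + 2 * bonus (χ₃ a b d)
    codegree-ad {d} o = +-cancelˡ-≡ (s + s) _ _ (begin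
      s + s + (codegree a d + β + bonus (χ₃ b c d))   ≡⟨ regroupˡ s β (codegree a d) (bonus (χ₃ b c d)) ⟩
      s + β + codegree a d + (s + bonus (χ₃ b c d))   ≡⟨ cong₂ (λ g y → g + codegree a d + y) codegree-ab (codegree-bd o) ⟨
      codegree a b + codegree a d + codegree b d      ≡⟨ law a≢b (≢-sym d≢a) (≢-sym d≢b) ⟩
      3 * s + 2 * bonus (χ₃ a b d)                    ≡⟨ regroupʳ s (bonus (χ₃ a b d)) ⟩
      s + s + (s + 2 * bonus (χ₃ a b d))              ∎)
      where
      open ≡-Reasoning
      d≢a = proj₁ (outside⇒≢ o)
      d≢b = proj₁ (proj₂ (outside⇒≢ o))
      regroupˡ : ∀ s β x t → s + s + (x + β + t) ≡ s + β + x + (s + t)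
      regroupˡ = solve-∀
      regroupʳ : ∀ s u → 3 * s + 2 * u ≡ s + s + (s + 2 * u)
      regroupʳ = solve-∀

    codegree-ad≤s+β : ∀ {d} → outside d ≡ true → codegree a d ≤ s + β
    codegree-ad≤s+β {d} o = +-cancelʳ-≤ β (codegree a d) (s + β) (begin
      codegree a d + β                      ≤⟨ m≤m+n (codegree a d + β) (bonus (χ₃ b c d)) ⟩
      codegree a d + β + bonus (χ₃ b c d)   ≡⟨ codegree-ad o ⟩
      s + 2 * bonus (χ₃ a b d)              ≤⟨ +-monoʳ-≤ s (*-monoʳ-≤ 2 (bonus≤β (χ₃ a b d))) ⟩
      s + 2 * β                             ≡⟨ regroup s β ⟩
      s + β + β                             ∎)
      where
      open ≤-Reasoning
      regroup : ∀ s β → s + 2 * β ≡ s + β + β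
      regroup = solve-∀

    fff-codegree-ad : ∀ {d} → outside d ≡ true → χ₃ a b d ≡ false → codegree a d + β ≡ s
    fff-codegree-ad {d} o abd∉ = begin
      codegree a d + β                       ≡⟨ +-identityʳ _ ⟨
      codegree a d + β + bonus false         ≡⟨ cong (λ t → codegree a d + β + bonus t) (profile-ab⇒bc (profile-outside o) abd∉) ⟨
      codegree a d + β + bonus (χ₃ b c d)    ≡⟨ codegree-ad o ⟩
      s + 2 * bonus (χ₃ a b d)               ≡⟨ cong (λ t → s + 2 * bonus t) abd∉ ⟩
      s + 0                                  ≡⟨ +-identityʳ s ⟩
      s                                      ∎
      where open ≡-Reasoning

    fff-no-outside-extension : ∀ {d e} → outside d ≡ true → χ₃ a b d ≡ false → outside e ≡ true → e ≢ d →
                               χ₃ a d e ≢ true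
    fff-no-outside-extension {d} {e} o abd∉ oₑ e≢d ade∈ = 6≤⇒≰2 (≤-trans 6≤β β≤s) s≤2
      where
      open ≤-Reasoning
      β≤s : β ≤ s
      β≤s = subst (β ≤_) (fff-codegree-ad o abd∉) (m≤n+m β (codegree a d))
      law-ade : codegree a d + codegree a e + codegree d e ≡ 3 * s + 2 * β
      law-ade = trans (law (≢-sym (proj₁ (outside⇒≢ o))) (≢-sym (proj₁ (outside⇒≢ oₑ))) (≢-sym e≢d))
                      (cong (λ t → 3 * s + 2 * t) (trans (cong bonus ade∈) bonus-true))
      de≤ : codegree d e ≤ β + β + 2
      de≤ = +-cancelʳ-≤ 2 _ _ (≤-trans (codegree+2≤n (≢-sym e≢d))
                                         (≤-reflexive (trans n≡2β+4 (sym (+-assoc (β + β) 2 2)))))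
      regroupˡ : ∀ s β → 2 * s + 3 * β + s ≡ β + (3 * s + 2 * β)
      regroupˡ = solve-∀
      regroupᵐ : ∀ β x x′ w → β + (x + x′ + w) ≡ x + β + x′ + w
      regroupᵐ = solve-∀
      regroupʳ : ∀ s β → s + (s + β) + (β + β + 2) ≡ 2 * s + 3 * β + 2
      regroupʳ = solve-∀
      s≤2 : s ≤ 2
      s≤2 = +-cancelˡ-≤ (2 * s + 3 * β) s 2 (begin
        2 * s + 3 * β + s                                   ≡⟨ regroupˡ s β ⟩
        β + (3 * s + 2 * β)                                 ≡⟨ cong (β +_) law-ade ⟨
        β + (codegree a d + codegree a e + codegree d e)    ≡⟨ regroupᵐ β (codegree a d) (codegree a e) (codegree d e) ⟩
        codegree a d + β + codegree a e + codegree d e      ≡⟨ cong (λ m → m + codegree a e + codegree d e) (fff-codegree-ad o abd∉) ⟩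
        s + codegree a e + codegree d e                     ≤⟨ +-mono-≤ (+-monoʳ-≤ s (codegree-ad≤s+β oₑ)) de≤ ⟩
        s + (s + β) + (β + β + 2)                           ≡⟨ regroupʳ s β ⟩
        2 * s + 3 * β + 2                                   ∎)

    fff-isolated : ∀ {d} → outside d ≡ true → χ₃ a b d ≡ false → ∀ {e} → e ≢ a → e ≢ d → χ₃ a d e ≡ false
    fff-isolated {d} o abd∉ {e} e≢a e≢d with point e
    ... | is-a refl = ⊥-elim (e≢a refl)
    ... | is-b refl = trans (sym (χ₃-comm₂₃ a b d)) abd∉
    ... | is-c refl = trans (sym (χ₃-comm₂₃ a c d)) (trans (profile-ac≡ab (profile-outside o)) abd∉)
    ... | is-outside oₑ with χ₃ a d e in ade
    ...   | false = refl
    ...   | true  = ⊥-elim (fff-no-outside-extension o abd∉ oₑ e≢d ade)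

    fff-codegree-ad≡0 : ∀ {d} → outside d ≡ true → χ₃ a b d ≡ false → codegree a d ≡ 0
    fff-codegree-ad≡0 o abd∉ = codegree≡0 (λ e e≢a e≢d → fff-isolated o abd∉ e≢a e≢d)

    fff⇒β≡s : ∀ {d} → outside d ≡ true → χ₃ a b d ≡ false → β ≡ s
    fff⇒β≡s o abd∉ = trans (cong (_+ β) (sym (fff-codegree-ad≡0 o abd∉))) (fff-codegree-ad o abd∉)

    fff⇒γ≡2 : ∀ {d} → outside d ≡ true → χ₃ a b d ≡ false → γ ≡ 2
    fff⇒γ≡2 o abd∉ = +-cancelˡ-≡ (3 + (k + β)) γ 2 (begin
      3 + (k + β) + γ       ≡⟨ +-assoc 3 (k + β) γ ⟩
      3 + (k + β + γ)       ≡⟨ n≡3+k+β+γ ⟨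
      n                     ≡⟨ n≡2β+4 ⟩
      β + β + 4             ≡⟨ cong (λ m → m + β + 4) (fff⇒β≡s o abd∉) ⟩
      suc k + β + 4         ≡⟨ regroup k β ⟩
      3 + (k + β) + 2       ∎)
      where
      open ≡-Reasoning
      regroup : ∀ k β → suc k + β + 4 ≡ 3 + (k + β) + 2
      regroup = solve-∀

    fff-partner : ∀ {d} → outside d ≡ true → χ₃ a b d ≡ false →
                  ∃[ d′ ] (d′ ≢ d × outside d′ ≡ true × χ₃ a b d′ ≡ false)
    fff-partner {d} o abd∉ = d′ , d′≢d , ∧-conicalˡ _ _ d′-fff , not-injective (∧-conicalʳ _ _ d′-fff)
      where
      fff? : Fin n → Bool
      fff? e = outside e ∧ not (χ₃ a b e)
      others : count (λ e → fff? e ∧ not (e == d)) ≡ 1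
      others = suc-injective (trans (sym (count-remove-true fff? (cong₂ (λ p q → p ∧ not q) o abd∉))) (fff⇒γ≡2 o abd∉))
      witness = count>0⇒∃ _ (subst (0 <_) (sym others) (s≤s z≤n))
      d′ = proj₁ witness
      d′-fff = proj₁ (∈-minus-point fff? (proj₂ witness))
      d′≢d = proj₂ (∈-minus-point fff? (proj₂ witness))

    abd∈X₁ : ∀ {d} → outside d ≡ true → χ₃ a b d ≡ true
    abd∈X₁ {d} o with χ₃ a b d in abd
    ... | true  = refl
    ... | false = ⊥-elim (6≤⇒≰2 (subst (6 ≤_) β≡s 6≤β) s≤2)
      where
      β≡s = fff⇒β≡s o abd
      partner = fff-partner o abd
      d′ = proj₁ partner
      d′≢d = proj₁ (proj₂ partner)
      o′ = proj₁ (proj₂ (proj₂ partner))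
      abd′ = proj₂ (proj₂ (proj₂ partner))
      dd′≡3s : codegree d d′ ≡ 3 * s
      dd′≡3s = begin
        codegree d d′                                  ≡⟨⟩
        0 + 0 + codegree d d′
          ≡⟨ cong₂ (λ x y → x + y + codegree d d′) (fff-codegree-ad≡0 o abd) (fff-codegree-ad≡0 o′ abd′) ⟨
        codegree a d + codegree a d′ + codegree d d′
          ≡⟨ law (≢-sym (proj₁ (outside⇒≢ o))) (≢-sym (proj₁ (outside⇒≢ o′))) (≢-sym d′≢d) ⟩
        3 * s + 2 * bonus (χ₃ a d d′)
          ≡⟨ cong (λ t → 3 * s + 2 * bonus t) (fff-isolated o abd (proj₁ (outside⇒≢ o′)) d′≢d) ⟩
        3 * s + 0                                      ≡⟨ +-identityʳ _ ⟩
        3 * s                                          ∎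
        where open ≡-Reasoning
      regroup : ∀ s → s + s + 2 + s ≡ 3 * s + 2
      regroup = solve-∀
      s≤2 : s ≤ 2
      s≤2 = +-cancelˡ-≤ (s + s + 2) s 2 (begin
        s + s + 2 + s         ≡⟨ regroup s ⟩
        3 * s + 2             ≡⟨ cong (_+ 2) dd′≡3s ⟨
        codegree d d′ + 2     ≤⟨ codegree+2≤n (≢-sym d′≢d) ⟩
        n                     ≡⟨ n≡2β+4 ⟩
        β + β + 4             ≡⟨ cong (λ m → m + m + 4) β≡s ⟩
        s + s + 4             ≡⟨ +-assoc (s + s) 2 2 ⟨
        s + s + 2 + 2         ∎)
        where open ≤-Reasoning

    γ≡0 : γ ≡ 0
    γ≡0 = count-false _ none
      where
      none : ∀ d → outside d ∧ not (χ₃ a b d) ≡ false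
      none d with outside d in o
      ... | false = refl
      ... | true  = cong not (abd∈X₁ o)

    k≡1+β : k ≡ suc β
    k≡1+β = +-cancelʳ-≡ β k (suc β) (+-cancelˡ-≡ 3 (k + β) (suc β + β) (begin
      3 + (k + β)         ≡⟨ cong (3 +_) (+-identityʳ (k + β)) ⟨
      3 + (k + β + 0)     ≡⟨ cong (λ g → 3 + (k + β + g)) γ≡0 ⟨
      3 + (k + β + γ)     ≡⟨ n≡3+k+β+γ ⟨
      n                   ≡⟨ n≡2β+4 ⟩
      β + β + 4           ≡⟨ regroup β ⟩
      3 + (suc β + β)     ∎))
      where
      open ≡-Reasoning
      regroup : ∀ β → β + β + 4 ≡ 3 + (suc β + β)
      regroup = solve-∀

    n≡s+s : n ≡ s + s
    n≡s+s = trans n≡2β+4 (trans (regroup β) (cong (λ m → suc m + suc m) (sym k≡1+β)))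
      where
      regroup : ∀ β → β + β + 4 ≡ suc (suc β) + suc (suc β)
      regroup = solve-∀

    far-pair : ∀ {x y} → x ≢ y → codegree x y ≡ s + β → ∀ z → z ≢ x → z ≢ y → χ₃ x y z ≡ true
    far-pair x≢y xy≡s+β = codegree+2≡n⇒χ₃ x≢y (trans (cong (_+ 2) xy≡s+β) s+β+2≡n)
      where
      regroup : ∀ β → suc (suc β) + β + 2 ≡ β + β + 4
      regroup = solve-∀
      s+β+2≡n : s + β + 2 ≡ n
      s+β+2≡n = trans (cong (λ m → suc m + β + 2) k≡1+β) (trans (regroup β) (sym n≡2β+4))

    side : Fin n → Bool
    side x = awayFrom b c x ∧ χ₃ b c x

    count-side : count side ≡ s
    count-side = codegree-bc

    count-other-side : count (not ∘ side) ≡ s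
    count-other-side = +-cancelˡ-≡ s _ _ (trans (cong (_+ count (not ∘ side)) (sym count-side))
                                                (trans (count-complement side) n≡s+s))

    side-a : side a ≡ true
    side-a = trans (cong (_∧ χ₃ b c a) (awayFrom-≢ a≢b a≢c)) (trans (sym (χ₃-rotate a b c)) abc∈X₁)

    side-b : side b ≡ false
    side-b rewrite ==-refl b = refl

    side-c : side c ≡ false
    side-c rewrite ==-refl c | ≢⇒==-false (≢-sym b≢c) = refl

    side-outside : ∀ {d} → outside d ≡ true → side d ≡ χ₃ b c d
    side-outside {d} o = let _ , d≢b , d≢c = outside⇒≢ o in cong (_∧ χ₃ b c d) (awayFrom-≢ d≢b d≢c)

    codegree-ad-outside : ∀ {d} → outside d ≡ true → codegree a d ≡ s + bonus (not (χ₃ b c d))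
    codegree-ad-outside {d} o = +-cancelʳ-≡ (β + t) (codegree a d) (s + t′) (begin
      codegree a d + (β + t)      ≡⟨ +-assoc (codegree a d) β t ⟨
      codegree a d + β + t        ≡⟨ codegree-ad o ⟩
      s + 2 * bonus (χ₃ a b d)    ≡⟨ cong (λ u → s + 2 * bonus u) (abd∈X₁ o) ⟩
      s + 2 * bonus true          ≡⟨ cong (λ m → s + 2 * m) (trans bonus-true (sym (bonus-complement (χ₃ b c d)))) ⟩
      s + 2 * (t + t′)            ≡⟨ regroup s t t′ ⟩
      s + t′ + (t + t′ + t)       ≡⟨ cong (λ m → s + t′ + (m + t)) (bonus-complement (χ₃ b c d)) ⟩
      s + t′ + (β + t)            ∎)
      where
      open ≡-Reasoning
      t = bonus (χ₃ b c d)
      t′ = bonus (not (χ₃ b c d))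
      regroup : ∀ s t t′ → s + 2 * (t + t′) ≡ s + t′ + (t + t′ + t)
      regroup = solve-∀

    codegree-from-a : ∀ {y} → y ≢ a → codegree a y ≡ s + bonus (not (side y))
    codegree-from-a {y} y≢a with point y
    ... | is-a refl = ⊥-elim (y≢a refl)
    ... | is-b refl rewrite side-b = trans codegree-ab (cong (s +_) (sym bonus-true))
    ... | is-c refl rewrite side-c = trans codegree-ac (cong (s +_) (sym bonus-true))
    ... | is-outside o = trans (codegree-ad-outside o) (cong (λ σ → s + bonus (not σ)) (sym (side-outside o)))

    codegree-from-b : ∀ {y} → y ≢ b → codegree b y ≡ s + bonus (side y)
    codegree-from-b {y} y≢b with point y
    ... | is-a refl rewrite side-a = trans (codegree-sym b a) (trans codegree-ab (cong (s +_) (sym bonus-true)))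
    ... | is-b refl = ⊥-elim (y≢b refl)
    ... | is-c refl rewrite side-c = trans codegree-bc (sym (+-identityʳ s))
    ... | is-outside o = trans (codegree-bd o) (cong (λ t → s + bonus t) (sym (side-outside o)))

    via-pivot : ∀ {p x y} → p ≢ x → p ≢ y → x ≢ y → codegree p x ≡ s + β →
                ∀ {t t′} → codegree p y ≡ s + t′ → t + t′ ≡ β → codegree x y ≡ s + t
    via-pivot {p} {x} {y} p≢x p≢y x≢y px {t} {t′} py t+t′≡β = +-cancelˡ-≡ (s + β + (s + t′)) _ _ (begin
      s + β + (s + t′) + codegree x y               ≡⟨ cong₂ (λ u v → u + v + codegree x y) px py ⟨
      codegree p x + codegree p y + codegree x y    ≡⟨ law p≢x p≢y x≢y ⟩
      3 * s + 2 * bonus (χ₃ p x y)                  ≡⟨ cong (λ u → 3 * s + 2 * bonus u) (far-pair p≢x px y (≢-sym p≢y) (≢-sym x≢y)) ⟩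
      3 * s + 2 * bonus true                        ≡⟨ cong (λ m → 3 * s + 2 * m) (trans bonus-true (sym t+t′≡β)) ⟩
      3 * s + 2 * (t + t′)                          ≡⟨ regroup s t t′ ⟩
      s + (t + t′) + (s + t′) + (s + t)             ≡⟨ cong (λ m → s + m + (s + t′) + (s + t)) t+t′≡β ⟩
      s + β + (s + t′) + (s + t)                    ∎)
      where
      open ≡-Reasoning
      regroup : ∀ s t t′ → 3 * s + 2 * (t + t′) ≡ s + (t + t′) + (s + t′) + (s + t)
      regroup = solve-∀

    codegree-away-from-ab : ∀ {x y} → x ≢ y → x ≢ a → x ≢ b → y ≢ a → y ≢ b →
                            codegree x y ≡ s + bonus (side x xor side y)
    codegree-away-from-ab {x} {y} x≢y x≢a x≢b y≢a y≢b with side x in σx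
    ... | true  = via-pivot (≢-sym x≢b) (≢-sym y≢b) x≢y
                    (trans (codegree-from-b x≢b) (trans (cong (λ σ → s + bonus σ) σx) (cong (s +_) bonus-true)))
                    (codegree-from-b y≢b) (trans (+-comm (bonus (not (side y))) (bonus (side y))) (bonus-complement (side y)))
    ... | false = via-pivot (≢-sym x≢a) (≢-sym y≢a) x≢y
                    (trans (codegree-from-a x≢a) (trans (cong (λ σ → s + bonus (not σ)) σx) (cong (s +_) bonus-true)))
                    (codegree-from-a y≢a) (bonus-complement (side y))

    codegree-side : ∀ {x y} → x ≢ y → codegree x y ≡ s + bonus (side x xor side y)
    codegree-side {x} {y} x≢y with point x | point y
    ... | is-a refl | _ rewrite side-a = codegree-from-a (≢-sym x≢y)
    ... | is-b refl | _ rewrite side-b = codegree-from-b (≢-sym x≢y)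
    ... | _ | is-a refl rewrite side-a | xor-comm (side x) true = trans (codegree-sym x a) (codegree-from-a x≢y)
    ... | _ | is-b refl rewrite side-b | xor-comm (side x) false = trans (codegree-sym x b) (codegree-from-b x≢y)
    ... | is-c refl | is-c refl = ⊥-elim (x≢y refl)
    ... | is-c refl | is-outside oy =
      codegree-away-from-ab x≢y (≢-sym a≢c) (≢-sym b≢c) (proj₁ (outside⇒≢ oy)) (proj₁ (proj₂ (outside⇒≢ oy)))
    ... | is-outside ox | is-c refl =
      codegree-away-from-ab x≢y (proj₁ (outside⇒≢ ox)) (proj₁ (proj₂ (outside⇒≢ ox))) (≢-sym a≢c) (≢-sym b≢c)
    ... | is-outside ox | is-outside oy =
      codegree-away-from-ab x≢y (proj₁ (outside⇒≢ ox)) (proj₁ (proj₂ (outside⇒≢ ox)))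
                                (proj₁ (outside⇒≢ oy)) (proj₁ (proj₂ (outside⇒≢ oy)))

    split-pair : ∀ {x y} → x ≢ y → side x xor side y ≡ true → codegree x y ≡ s + β
    split-pair x≢y apart = trans (codegree-side x≢y) (trans (cong (λ t → s + bonus t) apart) (cong (s +_) bonus-true))

    same-side : ∀ {x y} → x ≢ y → side x xor side y ≡ false → codegree x y ≡ s
    same-side x≢y together = trans (codegree-side x≢y) (trans (cong (λ t → s + bonus t) together) (+-identityʳ s))

    monochromatic∉X₁ : ∀ {x y z} → x ≢ y → x ≢ z → y ≢ z → side x xor side y ≡ false → side y xor side z ≡ false →
                       χ₃ x y z ≡ false
    monochromatic∉X₁ {x} {y} {z} x≢y x≢z y≢z xy yz =
      bonus≡0 (*-cancelˡ-≡ _ 0 2 (+-cancelˡ-≡ (3 * s) _ 0 (sym (begin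
        3 * s + 0                                     ≡⟨ +-identityʳ (3 * s) ⟩
        3 * s                                         ≡⟨ tripled s ⟩
        s + s + s                                     ≡⟨ cong₂ _+_ (cong₂ _+_ (same-side x≢y xy) (same-side x≢z xz)) (same-side y≢z yz) ⟨
        codegree x y + codegree x z + codegree y z    ≡⟨ law x≢y x≢z y≢z ⟩
        3 * s + 2 * bonus (χ₃ x y z)                  ∎))))
      where
      open ≡-Reasoning
      tripled : ∀ s → 3 * s ≡ s + s + s
      tripled = solve-∀
      xz : side x xor side z ≡ false
      xz = subst (λ σ → σ xor side z ≡ false) (sym (trans (xor≡false⇒≡ {side x} xy) (xor≡false⇒≡ {side y} yz)))
                 (xor-same (side z))
      bonus≡0 : ∀ {t} → bonus t ≡ 0 → t ≡ false
      bonus≡0 {false} _ = refl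
      bonus≡0 {true} β+0≡0 = ⊥-elim (6≤⇒≰2 6≤β (≤-trans (≤-reflexive (trans (sym bonus-true) β+0≡0)) z≤n))

    χ₃-side : ∀ {x y z} → x ≢ y → x ≢ z → y ≢ z → χ₃ x y z ≡ (side x xor side y) ∨ (side y xor side z)
    χ₃-side {x} {y} {z} x≢y x≢z y≢z with side x xor side y in xy | side y xor side z in yz
    ... | true  | _     = far-pair x≢y (split-pair x≢y xy) z (≢-sym x≢z) (≢-sym y≢z)
    ... | false | true  = trans (χ₃-rotate x y z) (far-pair y≢z (split-pair y≢z yz) x x≢y x≢z)
    ... | false | false = monochromatic∉X₁ x≢y x≢z y≢z xy yz

-- Two-colourings of [n]

record Enumeration {n : ℕ} (p : Fin n → Bool) (m₁ m₂ : ℕ) : Set where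
  field
    u : Fin m₁ → Fin n
    w : Fin m₂ → Fin n
    u-injective : ∀ i j → u i ≡ u j → i ≡ j
    w-injective : ∀ i j → w i ≡ w j → i ≡ j
    p∘u : ∀ i → p (u i) ≡ true
    p∘w : ∀ j → p (w j) ≡ false
    covers : ∀ x → (∃[ i ] u i ≡ x) ⊎ (∃[ j ] w j ≡ x)

module _ {n m₁ m₂ : ℕ} where

  swap-sides : {p q : Fin n → Bool} → (∀ x → q x ≡ not (p x)) → Enumeration p m₁ m₂ → Enumeration q m₂ m₁
  swap-sides q≡¬p E = record
    { u = w ; w = u ; u-injective = w-injective ; w-injective = u-injective
    ; p∘u = λ j → trans (q≡¬p (w j)) (cong not (p∘w j))
    ; p∘w = λ i → trans (q≡¬p (u i)) (cong not (p∘u i))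
    ; covers = Data.Sum.swap ∘ covers }
    where open Enumeration E

  enumeration-cons : {p : Fin (suc n) → Bool} → p zero ≡ true →
                     Enumeration (p ∘ suc) m₁ m₂ → Enumeration p (suc m₁) m₂
  enumeration-cons {p} p0 E = record
    { u = u′ ; w = suc ∘ w ; u-injective = u′-injective
    ; w-injective = λ i j → w-injective i j ∘ Data.Fin.Properties.suc-injective
    ; p∘u = λ { zero → p0 ; (suc i) → p∘u i } ; p∘w = p∘w ; covers = covers′ }
    where
    open Enumeration E
    u′ : Fin (suc m₁) → Fin (suc n)
    u′ zero = zero
    u′ (suc i) = suc (u i)
    u′-injective : ∀ i j → u′ i ≡ u′ j → i ≡ j
    u′-injective zero    zero    _ = refl
    u′-injective (suc i) (suc j) e = cong suc (u-injective i j (Data.Fin.Properties.suc-injective e))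
    covers′ : ∀ x → (∃[ i ] u′ i ≡ x) ⊎ (∃[ j ] suc (w j) ≡ x)
    covers′ zero = inj₁ (zero , refl)
    covers′ (suc x) with covers x
    ... | inj₁ (i , ui≡x) = inj₁ (suc i , cong suc ui≡x)
    ... | inj₂ (j , wj≡x) = inj₂ (j , cong suc wj≡x)

enumerate : {n : ℕ} (p : Fin n → Bool) → Enumeration p (count p) (count (not ∘ p))
enumerate {zero} p = record
  { u = λ () ; w = λ () ; u-injective = λ () ; w-injective = λ () ; p∘u = λ () ; p∘w = λ () ; covers = λ () }
enumerate {suc n} p with p zero in p0
... | true  = enumeration-cons p0 (enumerate (p ∘ suc))
... | false = swap-sides (λ x → sym (not-involutive (p x)))
                (enumeration-cons (cong not p0) (swap-sides (λ _ → refl) (enumerate (p ∘ suc))))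

enumeration-bijective : {n m₁ m₂ : ℕ} {p : Fin n → Bool} (E : Enumeration p m₁ m₂) →
                        let open Enumeration E in Bijective _≡_ _≡_ [ u , w ]
enumeration-bijective {p = p} E = injective , surjective
  where
  open Enumeration E
  injective : Injective _≡_ _≡_ [ u , w ]
  injective {inj₁ i} {inj₁ j} e = cong inj₁ (u-injective i j e)
  injective {inj₂ i} {inj₂ j} e = cong inj₂ (w-injective i j e)
  injective {inj₁ i} {inj₂ j} e = contradiction (trans (sym (p∘u i)) (trans (cong p e) (p∘w j))) λ ()
  injective {inj₂ i} {inj₁ j} e = contradiction (trans (sym (p∘u j)) (trans (cong p (sym e)) (p∘w i))) λ ()
  surjective : Surjective _≡_ _≡_ [ u , w ]
  surjective x with covers x
  ... | inj₁ (i , ui≡x) = inj₁ i , λ { refl → ui≡x }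
  ... | inj₂ (j , wj≡x) = inj₂ j , λ { refl → wj≡x }

module Bicoloured {n m : ℕ} {χ : Subset n → Bool} {side : Fin n → Bool} (E : Enumeration side m m)
  (χ-side : ∀ {x y z} → x ≢ y → x ≢ z → y ≢ z →
            χ (triple x y z) ≡ (side x xor side y) ∨ (side y xor side z))
  where

  open Enumeration E
  open Pi1 u w

  Y₂₃ : Subset n → Set
  Y₂₃ s = Y₂ s ⊎ Y₃ s

  u-≢ : ∀ {i j} → i ≢ j → u i ≢ u j
  u-≢ i≢j = i≢j ∘ u-injective _ _

  w-≢ : ∀ {i j} → i ≢ j → w i ≢ w j
  w-≢ i≢j = i≢j ∘ w-injective _ _

  u≢w : ∀ i j → u i ≢ w j
  u≢w i j e = contradiction (trans (sym (p∘u i)) (trans (cong side e) (p∘w j))) λ ()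

  UUU∉X₁ : ∀ {i j k} → i ≢ j → i ≢ k → j ≢ k → χ (triple (u i) (u j) (u k)) ≡ false
  UUU∉X₁ {i} {j} {k} i≢j i≢k j≢k rewrite χ-side (u-≢ i≢j) (u-≢ i≢k) (u-≢ j≢k) | p∘u i | p∘u j | p∘u k = refl

  WWW∉X₁ : ∀ {i j k} → i ≢ j → i ≢ k → j ≢ k → χ (triple (w i) (w j) (w k)) ≡ false
  WWW∉X₁ {i} {j} {k} i≢j i≢k j≢k rewrite χ-side (w-≢ i≢j) (w-≢ i≢k) (w-≢ j≢k) | p∘w i | p∘w j | p∘w k = refl

  UUW∈X₁ : ∀ {i j k} → i ≢ j → χ (triple (u i) (u j) (w k)) ≡ true
  UUW∈X₁ {i} {j} {k} i≢j rewrite χ-side (u-≢ i≢j) (u≢w i k) (u≢w j k) | p∘u i | p∘u j | p∘w k = refl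

  WWU∈X₁ : ∀ {i j k} → i ≢ j → χ (triple (w i) (w j) (u k)) ≡ true
  WWU∈X₁ {i} {j} {k} i≢j rewrite χ-side (w-≢ i≢j) (≢-sym (u≢w k i)) (≢-sym (u≢w k j)) | p∘w i | p∘w j | p∘u k = refl

  Y₁⇒∉X₁ : ∀ {s} → Y₁ s → χ s ≡ false
  Y₁⇒∉X₁ (i , j , k , i≢j , j≢k , i≢k , inj₁ refl) = UUU∉X₁ i≢j i≢k j≢k
  Y₁⇒∉X₁ (i , j , k , i≢j , j≢k , i≢k , inj₂ refl) = WWW∉X₁ i≢j i≢k j≢k

  Y₂₃⇒∈X₁ : ∀ {s} → Y₂₃ s → χ s ≡ true
  Y₂₃⇒∈X₁ (inj₁ (i , j , i≢j , inj₁ refl)) = UUW∈X₁ i≢j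
  Y₂₃⇒∈X₁ (inj₁ (i , j , i≢j , inj₂ refl)) = WWU∈X₁ i≢j
  Y₂₃⇒∈X₁ (inj₂ (i , j , k , i≢j , _ , _ , inj₁ refl)) = UUW∈X₁ i≢j
  Y₂₃⇒∈X₁ (inj₂ (i , j , k , i≢j , _ , _ , inj₂ refl)) = WWU∈X₁ i≢j

  UUW∈Y₂₃ : ∀ {i j} k → i ≢ j → Y₂₃ (triple (u i) (u j) (w k))
  UUW∈Y₂₃ {i} {j} k i≢j with k ≟ i | k ≟ j
  ... | yes refl | _        = inj₁ (k , j , i≢j , inj₁ refl)
  ... | no _     | yes refl = inj₁ (k , i , ≢-sym i≢j , inj₁ (triple-comm₁₂ (u i) (u k) (w k)))
  ... | no k≢i   | no k≢j   = inj₂ (i , j , k , i≢j , ≢-sym k≢j , ≢-sym k≢i , inj₁ refl)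

  WWU∈Y₂₃ : ∀ {i j} k → i ≢ j → Y₂₃ (triple (w i) (w j) (u k))
  WWU∈Y₂₃ {i} {j} k i≢j with k ≟ i | k ≟ j
  ... | yes refl | _        = inj₁ (k , j , i≢j , inj₂ refl)
  ... | no _     | yes refl = inj₁ (k , i , ≢-sym i≢j , inj₂ (triple-comm₁₂ (w i) (w k) (u k)))
  ... | no k≢i   | no k≢j   = inj₂ (i , j , k , i≢j , ≢-sym k≢j , ≢-sym k≢i , inj₂ refl)

  classify : ∀ {x y z} → x ≢ y → x ≢ z → y ≢ z → Y₁ (triple x y z) ⊎ Y₂₃ (triple x y z)
  classify {x} {y} {z} x≢y x≢z y≢z with covers x | covers y | covers z
  ... | inj₁ (i , refl) | inj₁ (j , refl) | inj₁ (k , refl) =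
    inj₁ (i , j , k , x≢y ∘ cong u , y≢z ∘ cong u , x≢z ∘ cong u , inj₁ refl)
  ... | inj₂ (i , refl) | inj₂ (j , refl) | inj₂ (k , refl) =
    inj₁ (i , j , k , x≢y ∘ cong w , y≢z ∘ cong w , x≢z ∘ cong w , inj₂ refl)
  ... | inj₁ (i , refl) | inj₁ (j , refl) | inj₂ (k , refl) = inj₂ (UUW∈Y₂₃ k (x≢y ∘ cong u))
  ... | inj₁ (i , refl) | inj₂ (k , refl) | inj₁ (j , refl) =
    inj₂ (subst Y₂₃ (sym (triple-comm₂₃ (u i) (w k) (u j))) (UUW∈Y₂₃ k (x≢z ∘ cong u)))
  ... | inj₂ (k , refl) | inj₁ (i , refl) | inj₁ (j , refl) =
    inj₂ (subst Y₂₃ (sym (triple-rotate (w k) (u i) (u j))) (UUW∈Y₂₃ k (y≢z ∘ cong u)))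
  ... | inj₂ (i , refl) | inj₂ (j , refl) | inj₁ (k , refl) = inj₂ (WWU∈Y₂₃ k (x≢y ∘ cong w))
  ... | inj₂ (i , refl) | inj₁ (k , refl) | inj₂ (j , refl) =
    inj₂ (subst Y₂₃ (sym (triple-comm₂₃ (w i) (u k) (w j))) (WWU∈Y₂₃ k (x≢z ∘ cong w)))
  ... | inj₁ (k , refl) | inj₂ (i , refl) | inj₂ (j , refl) =
    inj₂ (subst Y₂₃ (sym (triple-rotate (u k) (w i) (w j))) (WWU∈Y₂₃ k (y≢z ∘ cong w)))

  equals-Π₁ : EqualsPi1 χ u w
  equals-Π₁ = inj₁ λ s ∣s∣≡3 → let x , y , z , x≢y , x≢z , y≢z , s≡xyz = triple-view s ∣s∣≡3 in
    mk⇔ (∈X₁⇒Y₂₃ (subst (λ t → Y₁ t ⊎ Y₂₃ t) (sym s≡xyz) (classify x≢y x≢z y≢z))) Y₂₃⇒∈X₁ ,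
    mk⇔ (∉X₁⇒Y₁ (subst (λ t → Y₁ t ⊎ Y₂₃ t) (sym s≡xyz) (classify x≢y x≢z y≢z))) Y₁⇒∉X₁
    where
    ∈X₁⇒Y₂₃ : ∀ {s} → Y₁ s ⊎ Y₂₃ s → χ s ≡ true → Y₂₃ s
    ∈X₁⇒Y₂₃ (inj₁ y₁) χs = contradiction (trans (sym χs) (Y₁⇒∉X₁ y₁)) λ ()
    ∈X₁⇒Y₂₃ (inj₂ y₂₃) _ = y₂₃
    ∉X₁⇒Y₁ : ∀ {s} → Y₁ s ⊎ Y₂₃ s → χ s ≡ false → Y₁ s
    ∉X₁⇒Y₁ (inj₁ y₁) _ = y₁
    ∉X₁⇒Y₁ (inj₂ y₂₃) χs = contradiction (trans (sym (Y₂₃⇒∈X₁ y₂₃)) χs) λ ()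

mainTheorem3 :
    (n : ℕ) → n > 14 →
    (χ : Subset n → Bool) (p : Fin 2 → Fin 2 → ℕ) →
    IsEquitableWith n χ p →
    p zero zero ≡ p (suc zero) zero + (n ∸ 7) →
    p zero zero ≥ p (suc zero) (suc zero) →
    p zero zero ≥ 2 * n ∸ 7 →
    (a b c : Fin n) → a ≢ b → a ≢ c → b ≢ c →
    χ (triple a b c) ≡ true →
    pairCount χ a b ≡ pairCount χ a c →
    2 * pairCount χ a c ≡ 2 * pairCount χ b c + (n ∸ 4) →
    (∀ (d : Fin n) → d ≢ a → d ≢ b → d ≢ c →
       ((χ (triple a b d) , χ (triple a c d) , χ (triple b c d)) ≡ (true , true , true))
       ⊎ ((χ (triple a b d) , χ (triple a c d) , χ (triple b c d)) ≡ (true , true , false))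
       ⊎ ((χ (triple a b d) , χ (triple a c d) , χ (triple b c d)) ≡ (false , false , false))) →
    ∃[ m ] (n ≡ 2 * m × Σ[ u ∈ (Fin m → Fin n) ] Σ[ w ∈ (Fin m → Fin n) ] (Bijective _≡_ _≡_ [ u , w ] × EqualsPi1 χ u w))
mainTheorem3 n n>14 χ p equitable λ₂ _ _ a b c a≢b a≢c b≢c abc∈X₁ _ gap profiles =
  s , n≡2s , u , w , enumeration-bijective E , equals-Π₁
  where
  open Codegrees χ
  codegree-gap : 2 * codegree a c ≡ 2 * codegree b c + (n ∸ 4)
  codegree-gap = subst₂ (λ x y → 2 * x ≡ 2 * y + (n ∸ 4)) (pairCount≡codegree a≢c) (pairCount≡codegree b≢c) gap
  profile : ∀ {d} → d ≢ a → d ≢ b → d ≢ c → Profile (χ₃ a b d) (χ₃ a c d) (χ₃ b c d)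
  profile {d} d≢a d≢b d≢c = profile-from-triple (profiles d d≢a d≢b d≢c)
  open Configuration (p (suc zero) zero) (triangle-λ₂ equitable λ₂ (≤-trans (m≤m+n 7 8) n>14)) n>14
         a≢b a≢c b≢c abc∈X₁ codegree-gap profile
  n≡2s : n ≡ 2 * s
  n≡2s = trans n≡s+s (cong (s +_) (sym (+-identityʳ s)))
  E : Enumeration side s s
  E = subst₂ (Enumeration side) count-side count-other-side (enumerate side)
  open Enumeration E using (u; w)
  open Bicoloured {χ = χ} E χ₃-side using (equals-Π₁)
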